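{- For each $k\geq 3$ and $d>k(k-1)/2$ we have $\mathrm{ex}(n,H_d^{(k)})\geq \Omega_{k}\left(n^{k-k(k-1)/d}\right)$, while $d_{k-1}(H_d^{(k)})=1$.
   Context: For $k\geq 2$ and $d\geq 1$, the bipartite hedgehog $H_d^{(k)}$ is the $k$-uniform $k$-partite hypergraph with vertex set $[d]\sqcup[d]\sqcup\bigsqcup_{i=1}^{k-2}[d]^2$ (so $2d+(k-2)d^2$ vertices) and the $d^2$ edges $\{i, j, (i,j), \ldots, (i,j)\}$ for $(i,j)\in[d]^2$, where $i$ is taken in the first copy of $[d]$, $j$ in the second, and the copy of $(i,j)$ in each of the $k-2$ copies of $[d]^2$; i.e., it is obtained by extending each edge of $K_{d,d}$ to a $k$-edge with $k-2$ new vertices. For a $k$-uniform $H$, $d_{k-1}(H)$ is its usual degeneracy: the least $d$ such that every subhypergraph of $H$ has minimum degree at most $d$. $\mathrm{ex}(n,H)$ is the maximum number of edges in an $n$-vertex $k$-uniform hypergraph with no copy of $H$. $\Omega_k(f(n))$ denotes a quantity at least $cf(n)$ for a constant $c>0$ depending only on $k$ (for all sufficiently large $n$). -}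

module Defs where

open import Data.Nat using (ℕ; _+_; _*_; _∸_; _≤_; _≡ᵇ_)
open import Data.Bool using (Bool; _∨_)
open import Data.Fin using (Fin; toℕ)
open import Data.Fin.Subset using (Subset; _∈_; _⊆_; ∣_∣; Nonempty)
open import Data.Fin.Subset.Properties using (_∈?_)
open import Data.Vec using (tabulate)
open import Data.List using (List; length; filter; map; concatMap; upTo)
open import Data.Bool.ListAction using (any)
open import Data.List.Membership.Propositional using () renaming (_∈_ to _∈ₗ_)
open import Data.List.Relation.Unary.All using (All)
open import Data.List.Relation.Unary.Unique.Propositional using (Unique)
open import Data.Product using (Σ; ∃; _×_; _,_)
open import Relation.Binary.PropositionalEquality using (_≡_)
open import Function.Definitions using (Injective)
open import Relation.Nullary using (¬_)

Hypergraph : ℕ → Set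
Hypergraph n = List (Subset n)

IsUniform : ∀ {n} → ℕ → Hypergraph n → Set
IsUniform k E = All (λ e → ∣ e ∣ ≡ k) E × Unique E

numEdges : ∀ {n} → Hypergraph n → ℕ
numEdges E = length E

MapsOnto : ∀ {m n} → (Fin m → Fin n) → Subset m → Subset n → Set
MapsOnto {m} {n} φ e e' =
  (∀ (x : Fin m) → x ∈ e → φ x ∈ e') × (∀ (y : Fin n) → y ∈ e' → ∃ λ x → x ∈ e × φ x ≡ y)

ContainsCopy : ∀ {m n} → Hypergraph n → Hypergraph m → Set
ContainsCopy {m} {n} G H =
  Σ (Fin m → Fin n) λ φ → Injective _≡_ _≡_ φ ×
    All (λ e → Σ (Subset n) λ e' → e' ∈ₗ G × MapsOnto φ e e') H

degree : ∀ {m} → List (Subset m) → Fin m → ℕ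
degree F v = length (filter (v ∈?_) F)

IsSubhypergraph : ∀ {m} → Hypergraph m → Subset m → List (Subset m) → Set
IsSubhypergraph H S F = All (_∈ₗ H) F × Unique F × All (_⊆ S) F

DegenerateAtMost : ∀ {m} → Hypergraph m → ℕ → Set
DegenerateAtMost {m} H D =
  ∀ (S : Subset m) (F : List (Subset m)) → IsSubhypergraph H S F → Nonempty S →
    ∃ λ v → v ∈ S × degree F v ≤ D

DegeneracyIs : ∀ {m} → Hypergraph m → ℕ → Set
DegeneracyIs H D = DegenerateAtMost H D × (∀ D' → DegenerateAtMost H D' → D ≤ D')

-- Vertex numbering: first copy of [d]: i ↦ i ; second copy: j ↦ d + j ;
-- t-th copy (t < k-2) of [d]^2: (i,j) ↦ 2d + t*d*d + i*d + j   (0-based i, j, t).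
hedgehogVertexCount : ℕ → ℕ → ℕ
hedgehogVertexCount k d = d + d + (k ∸ 2) * (d * d)

inHedgehogEdge : ℕ → ℕ → ℕ → ℕ → ℕ → Bool
inHedgehogEdge k d i j x =
  (x ≡ᵇ i) ∨ (x ≡ᵇ (d + j)) ∨
  any (λ t → x ≡ᵇ (d + d + t * (d * d) + i * d + j)) (upTo (k ∸ 2))

hedgehogEdge : (k d : ℕ) → ℕ → ℕ → Subset (hedgehogVertexCount k d)
hedgehogEdge k d i j = tabulate (λ x → inHedgehogEdge k d i j (toℕ x))

hedgehog : (k d : ℕ) → Hypergraph (hedgehogVertexCount k d)
hedgehog k d = concatMap (λ i → map (λ j → hedgehogEdge k d i j) (upTo d)) (upTo d)

{-# OPTIONS --safe #-}

-- Deletion method. Split the vertex set into k blocks of M = ⌊n/k⌋ vertices and give every ordered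
-- pair of vertices one of r ≈ n^(1/d) colours, colour 0 meaning red. The candidate edges are the
-- transversals of the blocks whose k(k-1) ordered pairs are all red. A copy of H_d^(k) among the
-- candidates yields a red K_{d,d} (all 2d² ordered pairs between its sides red) whose first left and
-- first right vertex lie in a common candidate; so deleting every candidate that contains the first
-- left and first right vertex of some red K_{d,d} leaves a hedgehog-free hypergraph. Constraints on
-- m distinct pairs hold for exactly a fraction r^(-m) of all colourings, so on average there are
-- M^k r^(-k(k-1)) candidates, of which at most M^(k-2) (kM)^(2d) r^(-2d²) are deleted. Since
-- d > k(k-1)/2 this is at most half of them, and r^d ≈ n turns e(G) ≳ M^k r^(-k(k-1)) into
-- e(G)^d ≳ n^(kd - k(k-1)). The degeneracy is 1 because, for k ≥ 3, every edge of H_d^(k) has a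
-- vertex lying in no other edge.

module Submission where

open import Defs
open import Data.Nat using (ℕ; _+_; _*_; _∸_; _^_; _≤_; _<_; suc)
open import Data.Product using (Σ; _×_)
open import Relation.Nullary using (¬_)

open import Data.Bool using (Bool; T)
open import Data.Bool.Properties using (T-≡; T-∨)
open import Data.Empty using (⊥-elim)
open import Data.Fin as Fin
  using (Fin; zero; suc; toℕ; fromℕ<; inject≤; combine; remQuot; punchIn; punchOut; splitAt; _↑ˡ_; _↑ʳ_)
import Data.Fin.Properties as Finₚ
open import Data.Fin.Subset using (Subset; ∣_∣) renaming (_∈_ to _∈ₛ_)
open import Data.Fin.Subset.Properties using (_∈?_)
open import Data.List using (List; []; _∷_; _++_; map; length; filter; tabulate; allFin; upTo; cartesianProductWith)
open import Data.List.Properties using (length-++; length-map; length-tabulate; map-∘)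
open import Data.List.Membership.Propositional using (_∈_; _∉_; find)
import Data.List.Membership.Propositional.Properties as ∈ₚ
open import Data.List.Relation.Unary.All as All using (All; []; _∷_; all?; uncons)
import Data.List.Relation.Unary.All.Properties as Allₚ
open import Data.List.Relation.Unary.Any as Any using (here; there)
import Data.List.Relation.Unary.Any.Properties as Anyₚ
open import Data.List.Relation.Unary.AllPairs using ([]; _∷_)
open import Data.List.Relation.Unary.Unique.Propositional using (Unique)
import Data.List.Relation.Unary.Unique.Propositional.Properties as Uniqueₚ
open import Data.Nat using (zero; _<?_; _≟_; _≡ᵇ_; z≤n; s≤s; NonZero; >-nonZero)
open import Data.Nat.DivMod
  using (_/_; _%_; m≡m%n+[m/n]*n; m%n<n; m/n≤m; m/n*n≤m; m≥n⇒m/n>0; m<n⇒m%n≡m; [m+kn]%n≡m%n)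
open import Data.Nat.Properties
open import Algebra.Properties.CommutativeSemigroup +-commutativeSemigroup using () renaming (interchange to +-interchange)
open import Algebra.Properties.CommutativeSemigroup *-commutativeSemigroup using () renaming (interchange to *-interchange)
open import Data.Nat.Tactic.RingSolver using (solve-∀)
open import Data.Product as Product using (∃; ∃₂; _,_; proj₁; proj₂; swap; uncurry; map₂)
open import Data.Sum using (_⊎_; inj₁; inj₂)
open import Data.Vec as Vec using (Vec; []; _∷_; lookup; _[_]≔_)
import Data.Vec.Properties as Vecₚ
open import Function using (id; _∘_; _⇔_; mk⇔; Equivalence)
open import Level using (Level)
open import Relation.Nullary using (Dec; yes; no; isYes)
open import Relation.Nullary.Decidable using (_×-dec_; _→-dec_; ¬?; fromWitness; toWitness)
open import Relation.Unary using (Decidable)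
open import Relation.Binary.PropositionalEquality

private variable
  a ℓ : Level
  A B C : Set a
  P P′ : Set ℓ
  q m : ℕ

-- Finite sums and indicators

∑ : List A → (A → ℕ) → ℕ
∑ []       F = 0
∑ (x ∷ xs) F = F x + ∑ xs F

syntax ∑ xs (λ x → F) = ∑[ x ∈ xs ] F

∑-cong : ∀ xs {F G : A → ℕ} → (∀ x → F x ≡ G x) → ∑ xs F ≡ ∑ xs G
∑-cong []       F≗G = refl
∑-cong (x ∷ xs) F≗G = cong₂ _+_ (F≗G x) (∑-cong xs F≗G)

∑-mono-≤ : ∀ xs {F G : A → ℕ} → (∀ x → F x ≤ G x) → ∑ xs F ≤ ∑ xs G
∑-mono-≤ []       F≤G = z≤n
∑-mono-≤ (x ∷ xs) F≤G = +-mono-≤ (F≤G x) (∑-mono-≤ xs F≤G)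

∑-distrib-+ : ∀ xs (F G : A → ℕ) → ∑[ x ∈ xs ] (F x + G x) ≡ ∑ xs F + ∑ xs G
∑-distrib-+ []       F G = refl
∑-distrib-+ (x ∷ xs) F G = begin
  F x + G x + ∑[ x ∈ xs ] (F x + G x) ≡⟨ cong (F x + G x +_) (∑-distrib-+ xs F G) ⟩
  F x + G x + (∑ xs F + ∑ xs G)       ≡⟨ +-interchange (F x) (G x) (∑ xs F) (∑ xs G) ⟩
  F x + ∑ xs F + (G x + ∑ xs G)       ∎
  where open ≡-Reasoning

*-distribˡ-∑ : ∀ c xs (F : A → ℕ) → c * ∑ xs F ≡ ∑[ x ∈ xs ] (c * F x)
*-distribˡ-∑ c []       F = *-zeroʳ c
*-distribˡ-∑ c (x ∷ xs) F = trans (*-distribˡ-+ c (F x) (∑ xs F)) (cong (c * F x +_) (*-distribˡ-∑ c xs F))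

*-distribʳ-∑ : ∀ c xs (F : A → ℕ) → ∑ xs F * c ≡ ∑[ x ∈ xs ] (F x * c)
*-distribʳ-∑ c xs F = trans (*-comm (∑ xs F) c) (trans (*-distribˡ-∑ c xs F) (∑-cong xs λ x → *-comm c (F x)))

∑-const : ∀ (xs : List A) c → ∑[ x ∈ xs ] c ≡ length xs * c
∑-const []       c = refl
∑-const (x ∷ xs) c = cong (c +_) (∑-const xs c)

∑-++ : ∀ xs ys (F : A → ℕ) → ∑ (xs ++ ys) F ≡ ∑ xs F + ∑ ys F
∑-++ []       ys F = refl
∑-++ (x ∷ xs) ys F = trans (cong (F x +_) (∑-++ xs ys F)) (sym (+-assoc (F x) (∑ xs F) (∑ ys F)))

∈⇒≤∑ : ∀ {xs} (F : A → ℕ) {x} → x ∈ xs → F x ≤ ∑ xs F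
∈⇒≤∑ {xs = y ∷ xs} F (here refl) = m≤m+n (F y) (∑ xs F)
∈⇒≤∑ {xs = y ∷ xs} F (there x∈) = ≤-trans (∈⇒≤∑ F x∈) (m≤n+m (∑ xs F) (F y))

∑-<⇒∃-< : ∀ xs (F G : A → ℕ) → ∑ xs F < ∑ xs G → ∃ λ x → F x < G x
∑-<⇒∃-< (x ∷ xs) F G ∑F<∑G with F x <? G x
... | yes Fx<Gx = x , Fx<Gx
... | no  Fx≮Gx = ∑-<⇒∃-< xs F G (+-cancelˡ-< (G x) (∑ xs F) (∑ xs G)
                    (≤-<-trans (+-monoˡ-≤ (∑ xs F) (≮⇒≥ Fx≮Gx)) ∑F<∑G))

∑-≤⇒∃-≤ : ∀ xs (F G : A → ℕ) → 0 < length xs → ∑ xs F ≤ ∑ xs G → ∃ λ x → F x ≤ G x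
∑-≤⇒∃-≤ xs F G nonempty ∑F≤∑G with ∑-<⇒∃-< xs F (suc ∘ G) (begin-strict
  ∑ xs F                    ≤⟨ ∑F≤∑G ⟩
  ∑ xs G                    <⟨ m<m+n (∑ xs G) nonempty ⟩
  ∑ xs G + length xs        ≡⟨ cong (∑ xs G +_) (*-identityʳ (length xs)) ⟨
  ∑ xs G + length xs * 1    ≡⟨ cong (∑ xs G +_) (∑-const xs 1) ⟨
  ∑ xs G + ∑[ x ∈ xs ] 1    ≡⟨ +-comm (∑ xs G) _ ⟩
  ∑[ x ∈ xs ] 1 + ∑ xs G    ≡⟨ ∑-distrib-+ xs (λ _ → 1) G ⟨
  ∑ xs (suc ∘ G)            ∎)
  where open ≤-Reasoning
... | x , Fx<1+Gx = x , ≤-pred Fx<1+Gx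

∑-map : ∀ (h : A → B) xs (F : B → ℕ) → ∑ (map h xs) F ≡ ∑[ x ∈ xs ] F (h x)
∑-map h []       F = refl
∑-map h (x ∷ xs) F = cong (F (h x) +_) (∑-map h xs F)

∑-comm : ∀ xs ys (F : A → B → ℕ) → ∑[ x ∈ xs ] ∑[ y ∈ ys ] F x y ≡ ∑[ y ∈ ys ] ∑[ x ∈ xs ] F x y
∑-comm []       ys F = sym (trans (∑-const ys 0) (*-zeroʳ (length ys)))
∑-comm (x ∷ xs) ys F = trans (cong (∑ ys (F x) +_) (∑-comm xs ys F))
                              (sym (∑-distrib-+ ys (F x) λ y → ∑[ x ∈ xs ] F x y))

∑-tabulate : ∀ {n} (g : Fin n → A) (F : A → ℕ) → ∑ (tabulate g) F ≡ ∑[ i ∈ allFin n ] F (g i)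
∑-tabulate {n = zero}  g F = refl
∑-tabulate {n = suc n} g F = cong (F (g zero) +_)
  (trans (∑-tabulate (g ∘ Fin.suc) F) (sym (∑-tabulate Fin.suc (F ∘ g))))

∑-allFin-suc : ∀ {n} (F : Fin (suc n) → ℕ) → ∑ (allFin (suc n)) F ≡ F zero + ∑[ i ∈ allFin n ] F (suc i)
∑-allFin-suc F = cong (F zero +_) (∑-tabulate Fin.suc F)

length-allFin : ∀ n → length (allFin n) ≡ n
length-allFin n = length-tabulate {n = n} id

∑-allFin-const : ∀ n c → ∑[ i ∈ allFin n ] c ≡ n * c
∑-allFin-const n c = trans (∑-const (allFin n) c) (cong (_* c) (length-allFin n))

∑-cartesianProductWith : ∀ (g : A → B → C) xs ys (F : C → ℕ) →
  ∑ (cartesianProductWith g xs ys) F ≡ ∑[ x ∈ xs ] ∑[ y ∈ ys ] F (g x y)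
∑-cartesianProductWith g []       ys F = refl
∑-cartesianProductWith g (x ∷ xs) ys F =
  trans (∑-++ (map (g x) ys) _ F) (cong₂ _+_ (∑-map (g x) ys F) (∑-cartesianProductWith g xs ys F))

length-cartesianProductWith : ∀ (g : A → B → C) xs ys →
  length (cartesianProductWith g xs ys) ≡ length xs * length ys
length-cartesianProductWith g []       ys = refl
length-cartesianProductWith g (x ∷ xs) ys = trans (length-++ (map (g x) ys))
  (cong₂ _+_ (length-map (g x) ys) (length-cartesianProductWith g xs ys))

𝟙 : Dec P → ℕ
𝟙 (yes _) = 1
𝟙 (no  _) = 0

𝟙-yes : (P? : Dec P) → P → 𝟙 P? ≡ 1
𝟙-yes (yes _) _  = refl
𝟙-yes (no ¬p) pr = ⊥-elim (¬p pr)

𝟙-no : (P? : Dec P) → ¬ P → 𝟙 P? ≡ 0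
𝟙-no (yes pr) ¬p = ⊥-elim (¬p pr)
𝟙-no (no _)   _  = refl

𝟙-cong : (P? : Dec P) (P′? : Dec P′) → P ⇔ P′ → 𝟙 P? ≡ 𝟙 P′?
𝟙-cong (yes pr) P′? P⇔P′ = sym (𝟙-yes P′? (Equivalence.to P⇔P′ pr))
𝟙-cong (no ¬p)  P′? P⇔P′ = sym (𝟙-no P′? (¬p ∘ Equivalence.from P⇔P′))

𝟙-× : (P? : Dec P) (P′? : Dec P′) → 𝟙 (P? ×-dec P′?) ≡ 𝟙 P? * 𝟙 P′?
𝟙-× (yes _) (yes _) = refl
𝟙-× (yes _) (no _)  = refl
𝟙-× (no _)  _       = refl

𝟙≤𝟙[×≡0]+ : (P? : Dec P) (n : ℕ) → 𝟙 P? ≤ 𝟙 (P? ×-dec (n ≟ 0)) + n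
𝟙≤𝟙[×≡0]+ (no _)  n       = z≤n
𝟙≤𝟙[×≡0]+ (yes _) zero    = ≤-refl
𝟙≤𝟙[×≡0]+ (yes _) (suc n) = s≤s z≤n

length-filter : ∀ {Pred : A → Set ℓ} (P? : Decidable Pred) xs →
  length (filter P? xs) ≡ ∑[ x ∈ xs ] 𝟙 (P? x)
length-filter P? [] = refl
length-filter P? (x ∷ xs) with P? x
... | yes _ = cong suc (length-filter P? xs)
... | no  _ = length-filter P? xs

∑-δ : ∀ {n} (a : Fin n) (h : Fin n → ℕ) → ∑[ x ∈ allFin n ] (𝟙 (x Finₚ.≟ a) * h x) ≡ h a
∑-δ {suc n} zero h = begin
  ∑[ x ∈ allFin (suc n) ] (𝟙 (x Finₚ.≟ zero) * h x)
    ≡⟨ ∑-allFin-suc (λ x → 𝟙 (x Finₚ.≟ zero) * h x) ⟩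
  1 * h zero + ∑[ x ∈ allFin n ] (𝟙 (suc x Finₚ.≟ zero) * h (suc x))
    ≡⟨ cong₂ _+_ (*-identityˡ (h zero)) (∑-allFin-const n 0) ⟩
  h zero + n * 0
    ≡⟨ trans (cong (h zero +_) (*-zeroʳ n)) (+-identityʳ (h zero)) ⟩
  h zero ∎
  where open ≡-Reasoning
∑-δ {suc n} (suc a) h = begin
  ∑[ x ∈ allFin (suc n) ] (𝟙 (x Finₚ.≟ suc a) * h x)
    ≡⟨ ∑-allFin-suc (λ x → 𝟙 (x Finₚ.≟ suc a) * h x) ⟩
  ∑[ x ∈ allFin n ] (𝟙 (suc x Finₚ.≟ suc a) * h (suc x))
    ≡⟨ ∑-cong (allFin n) (λ x → cong (_* h (suc x)) (𝟙-cong (suc x Finₚ.≟ suc a) (x Finₚ.≟ a) suc≡suc⇔≡)) ⟩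
  ∑[ x ∈ allFin n ] (𝟙 (x Finₚ.≟ a) * h (suc x))
    ≡⟨ ∑-δ a (h ∘ suc) ⟩
  h (suc a) ∎
  where
  open ≡-Reasoning
  suc≡suc⇔≡ : ∀ {x} → suc x ≡ suc a ⇔ x ≡ a
  suc≡suc⇔≡ = mk⇔ Finₚ.suc-injective (cong suc)

-- Counting vectors under coordinate constraints

vectors : ∀ q m → List (Vec (Fin q) m)
vectors q zero    = [] ∷ []
vectors q (suc m) = cartesianProductWith _∷_ (allFin q) (vectors q m)

∈-vectors : (f : Vec (Fin q) m) → f ∈ vectors q m
∈-vectors []      = here refl
∈-vectors (x ∷ f) = ∈ₚ.∈-cartesianProductWith⁺ _∷_ (∈ₚ.∈-allFin x) (∈-vectors f)

vectors-unique : ∀ q m → Unique (vectors q m)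
vectors-unique q zero    = [] ∷ []
vectors-unique q (suc m) = Uniqueₚ.cartesianProductWith⁺ _∷_ Vecₚ.∷-injective (Uniqueₚ.allFin⁺ q) (vectors-unique q m)

∑-vectors-suc : ∀ (F : Vec (Fin q) (suc m) → ℕ) →
  ∑ (vectors q (suc m)) F ≡ ∑[ a ∈ allFin q ] ∑[ f ∈ vectors q m ] F (a ∷ f)
∑-vectors-suc = ∑-cartesianProductWith _∷_ (allFin _) (vectors _ _)

length-vectors : ∀ q m → length (vectors q m) ≡ q ^ m
length-vectors q zero    = refl
length-vectors q (suc m) = trans (length-cartesianProductWith _∷_ (allFin q) (vectors q m))
  (cong₂ _*_ (length-allFin q) (length-vectors q m))

∑-vectors-const : ∀ q m c → ∑[ f ∈ vectors q m ] c ≡ q ^ m * c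
∑-vectors-const q m c = trans (∑-const (vectors q m) c) (cong (_* c) (length-vectors q m))

∑-𝟙≟ : ∀ (a : Fin q) → ∑[ x ∈ allFin q ] 𝟙 (a Finₚ.≟ x) ≡ 1
∑-𝟙≟ {q = q} a = begin
  ∑[ x ∈ allFin q ] 𝟙 (a Finₚ.≟ x)
    ≡⟨ ∑-cong (allFin q) (λ x → 𝟙-cong (a Finₚ.≟ x) (x Finₚ.≟ a) (mk⇔ sym sym)) ⟩
  ∑[ x ∈ allFin q ] 𝟙 (x Finₚ.≟ a)
    ≡⟨ ∑-cong (allFin q) (λ x → *-identityʳ (𝟙 (x Finₚ.≟ a))) ⟨
  ∑[ x ∈ allFin q ] (𝟙 (x Finₚ.≟ a) * 1)
    ≡⟨ ∑-δ a (λ _ → 1) ⟩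
  1 ∎
  where open ≡-Reasoning

IgnoresCoordinate : Fin m → (Vec (Fin q) m → ℕ) → Set
IgnoresCoordinate p F = ∀ f a → F (f [ p ]≔ a) ≡ F f

∑-fix-head : ∀ (F : Vec (Fin q) (suc m) → ℕ) a →
  ∑[ f ∈ vectors q (suc m) ] (𝟙 (lookup f zero Finₚ.≟ a) * F f) ≡ ∑[ f ∈ vectors q m ] F (a ∷ f)
∑-fix-head {q = q} {m = m} F a = begin
  ∑[ f ∈ vectors q (suc m) ] (𝟙 (lookup f zero Finₚ.≟ a) * F f)
    ≡⟨ ∑-vectors-suc (λ f → 𝟙 (lookup f zero Finₚ.≟ a) * F f) ⟩
  ∑[ x ∈ allFin q ] ∑[ f ∈ vectors q m ] (𝟙 (x Finₚ.≟ a) * F (x ∷ f))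
    ≡⟨ ∑-cong (allFin q) (λ x → *-distribˡ-∑ (𝟙 (x Finₚ.≟ a)) (vectors q m) (F ∘ (x ∷_))) ⟨
  ∑[ x ∈ allFin q ] (𝟙 (x Finₚ.≟ a) * ∑[ f ∈ vectors q m ] F (x ∷ f))
    ≡⟨ ∑-δ a (λ x → ∑[ f ∈ vectors q m ] F (x ∷ f)) ⟩
  ∑[ f ∈ vectors q m ] F (a ∷ f) ∎
  where open ≡-Reasoning

∑-fix-coordinate : ∀ (p : Fin m) (F : Vec (Fin q) m → ℕ) → IgnoresCoordinate p F → ∀ a b →
  ∑[ f ∈ vectors q m ] (𝟙 (lookup f p Finₚ.≟ a) * F f) ≡ ∑[ f ∈ vectors q m ] (𝟙 (lookup f p Finₚ.≟ b) * F f)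
∑-fix-coordinate {m = suc m} {q = q} zero F ignores a b = begin
  ∑[ f ∈ vectors q (suc m) ] (𝟙 (lookup f zero Finₚ.≟ a) * F f) ≡⟨ ∑-fix-head F a ⟩
  ∑[ f ∈ vectors q m ] F (a ∷ f)                                 ≡⟨ ∑-cong (vectors q m) (λ f → ignores (b ∷ f) a) ⟩
  ∑[ f ∈ vectors q m ] F (b ∷ f)                                 ≡⟨ ∑-fix-head F b ⟨
  ∑[ f ∈ vectors q (suc m) ] (𝟙 (lookup f zero Finₚ.≟ b) * F f) ∎
  where open ≡-Reasoning
∑-fix-coordinate {m = suc m} {q = q} (suc p) F ignores a b = begin
  ∑[ f ∈ vectors q (suc m) ] (𝟙 (lookup f (suc p) Finₚ.≟ a) * F f)
    ≡⟨ ∑-vectors-suc (λ f → 𝟙 (lookup f (suc p) Finₚ.≟ a) * F f) ⟩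
  ∑[ x ∈ allFin q ] ∑[ f ∈ vectors q m ] (𝟙 (lookup f p Finₚ.≟ a) * F (x ∷ f))
    ≡⟨ ∑-cong (allFin q) (λ x → ∑-fix-coordinate p (F ∘ (x ∷_)) (λ f → ignores (x ∷ f)) a b) ⟩
  ∑[ x ∈ allFin q ] ∑[ f ∈ vectors q m ] (𝟙 (lookup f p Finₚ.≟ b) * F (x ∷ f))
    ≡⟨ ∑-vectors-suc (λ f → 𝟙 (lookup f (suc p) Finₚ.≟ b) * F f) ⟨
  ∑[ f ∈ vectors q (suc m) ] (𝟙 (lookup f (suc p) Finₚ.≟ b) * F f) ∎
  where open ≡-Reasoning

∑-split-coordinate : ∀ (p : Fin m) (F : Vec (Fin q) m → ℕ) → IgnoresCoordinate p F → ∀ a →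
  ∑ (vectors q m) F ≡ q * ∑[ f ∈ vectors q m ] (𝟙 (lookup f p Finₚ.≟ a) * F f)
∑-split-coordinate {m = m} {q = q} p F ignores a = begin
  ∑ (vectors q m) F
    ≡⟨ ∑-cong (vectors q m) (λ f → trans (cong (_* F f) (∑-𝟙≟ (lookup f p))) (*-identityˡ (F f))) ⟨
  ∑[ f ∈ vectors q m ] (∑[ b ∈ allFin q ] 𝟙 (lookup f p Finₚ.≟ b) * F f)
    ≡⟨ ∑-cong (vectors q m) (λ f → *-distribʳ-∑ (F f) (allFin q) (λ b → 𝟙 (lookup f p Finₚ.≟ b))) ⟩
  ∑[ f ∈ vectors q m ] ∑[ b ∈ allFin q ] (𝟙 (lookup f p Finₚ.≟ b) * F f)
    ≡⟨ ∑-comm (vectors q m) (allFin q) (λ f b → 𝟙 (lookup f p Finₚ.≟ b) * F f) ⟩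
  ∑[ b ∈ allFin q ] ∑[ f ∈ vectors q m ] (𝟙 (lookup f p Finₚ.≟ b) * F f)
    ≡⟨ ∑-cong (allFin q) (λ b → ∑-fix-coordinate p F ignores b a) ⟩
  ∑[ b ∈ allFin q ] ∑[ f ∈ vectors q m ] (𝟙 (lookup f p Finₚ.≟ a) * F f)
    ≡⟨ ∑-allFin-const q _ ⟩
  q * ∑[ f ∈ vectors q m ] (𝟙 (lookup f p Finₚ.≟ a) * F f)
    ∎
  where open ≡-Reasoning

Constraint : ℕ → ℕ → Set
Constraint q m = Fin m × Fin q

Satisfies : List (Constraint q m) → Vec (Fin q) m → Set
Satisfies cs f = All (λ (p , a) → lookup f p ≡ a) cs

satisfies? : ∀ (cs : List (Constraint q m)) f → Dec (Satisfies cs f)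
satisfies? cs f = all? (λ (p , a) → lookup f p Finₚ.≟ a) cs

#solutions : List (Constraint q m) → ℕ
#solutions {q = q} {m = m} cs = ∑[ f ∈ vectors q m ] 𝟙 (satisfies? cs f)

satisfies-local : ∀ {cs : List (Constraint q m)} {f g} →
  (∀ {p} → p ∈ map proj₁ cs → lookup f p ≡ lookup g p) → Satisfies cs f → Satisfies cs g
satisfies-local {cs = []}    f≈g []           = []
satisfies-local {cs = _ ∷ _} {f} {g} f≈g (fp≡a ∷ sat) =
  trans (sym (f≈g (here refl))) fp≡a ∷ satisfies-local {f = f} {g} (f≈g ∘ there) sat

satisfies-ignores : ∀ {cs : List (Constraint q m)} {p} → p ∉ map proj₁ cs →
  IgnoresCoordinate p (𝟙 ∘ satisfies? cs)
satisfies-ignores {cs = cs} {p} p∉ f a = 𝟙-cong (satisfies? cs (f [ p ]≔ a)) (satisfies? cs f) (mk⇔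
  (satisfies-local {f = f [ p ]≔ a} {f} update-invisible) (satisfies-local {f = f} {f [ p ]≔ a} (sym ∘ update-invisible)))
  where
  update-invisible : ∀ {p′} → p′ ∈ map proj₁ cs → lookup (f [ p ]≔ a) p′ ≡ lookup f p′
  update-invisible p′∈ = Vecₚ.lookup∘update′ (λ p′≡p → p∉ (subst (_∈ map proj₁ cs) p′≡p p′∈)) f a

𝟙-satisfies-∷ : ∀ (p : Fin m) (a : Fin q) cs f →
  𝟙 (satisfies? ((p , a) ∷ cs) f) ≡ 𝟙 (lookup f p Finₚ.≟ a) * 𝟙 (satisfies? cs f)
𝟙-satisfies-∷ p a cs f = trans
  (𝟙-cong (satisfies? ((p , a) ∷ cs) f) (lookup f p Finₚ.≟ a ×-dec satisfies? cs f) (mk⇔ uncons (uncurry _∷_)))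
  (𝟙-× (lookup f p Finₚ.≟ a) (satisfies? cs f))

#solutions-* : ∀ (cs : List (Constraint q m)) → Unique (map proj₁ cs) →
  #solutions cs * q ^ length cs ≡ q ^ m
#solutions-* {q = q} {m = m} [] _ = trans (*-identityʳ _) (trans (∑-vectors-const q m 1) (*-identityʳ (q ^ m)))
#solutions-* {q = q} {m = m} ((p , a) ∷ cs) (p∉cs ∷ unique) = begin
  #solutions ((p , a) ∷ cs) * (q * q ^ length cs)
    ≡⟨ *-assoc (#solutions ((p , a) ∷ cs)) q _ ⟨
  #solutions ((p , a) ∷ cs) * q * q ^ length cs
    ≡⟨ cong (_* q ^ length cs) (*-comm _ q) ⟩
  q * #solutions ((p , a) ∷ cs) * q ^ length cs
    ≡⟨ cong (λ n → q * n * q ^ length cs) (∑-cong (vectors q m) (𝟙-satisfies-∷ p a cs)) ⟩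
  q * ∑[ f ∈ vectors q m ] (𝟙 (lookup f p Finₚ.≟ a) * 𝟙 (satisfies? cs f)) * q ^ length cs
    ≡⟨ cong (_* q ^ length cs) (∑-split-coordinate p (𝟙 ∘ satisfies? cs) p-free a) ⟨
  #solutions cs * q ^ length cs
    ≡⟨ #solutions-* cs unique ⟩
  q ^ m ∎
  where
  open ≡-Reasoning
  p-free : IgnoresCoordinate p (𝟙 ∘ satisfies? cs)
  p-free = satisfies-ignores (Allₚ.All¬⇒¬Any p∉cs)

-- Lists of ordered pairs

↑ˡ≢↑ʳ : ∀ {m n} (i : Fin m) (j : Fin n) → i ↑ˡ n ≢ m ↑ʳ j
↑ˡ≢↑ʳ {m} {n} i j eq
  with () ← trans (sym (Finₚ.splitAt-↑ˡ m i n)) (trans (cong (splitAt m) eq) (Finₚ.splitAt-↑ʳ m n j))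

offDiagonal : ∀ n → List (Fin (suc n) × Fin (suc n))
offDiagonal n = cartesianProductWith (λ i j → i , punchIn i j) (allFin (suc n)) (allFin n)

offDiagonal-unique : ∀ n → Unique (offDiagonal n)
offDiagonal-unique n =
  Uniqueₚ.cartesianProductWith⁺ _ punchIn-pair-injective (Uniqueₚ.allFin⁺ (suc n)) (Uniqueₚ.allFin⁺ n)
  where
  punchIn-pair-injective : ∀ {i i′ j j′} → (i , punchIn i j) ≡ (i′ , punchIn i′ j′) → i ≡ i′ × j ≡ j′
  punchIn-pair-injective {i} {j = j} {j′} eq with refl ← cong proj₁ eq =
    refl , Finₚ.punchIn-injective i j j′ (cong proj₂ eq)

∈-offDiagonal : ∀ {n} {i j : Fin (suc n)} → i ≢ j → (i , j) ∈ offDiagonal n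
∈-offDiagonal {i = i} {j} i≢j = subst (λ j′ → (i , j′) ∈ _) (Finₚ.punchIn-punchOut i≢j)
  (∈ₚ.∈-cartesianProductWith⁺ (λ i j → i , punchIn i j) (∈ₚ.∈-allFin i) (∈ₚ.∈-allFin (punchOut i≢j)))

length-offDiagonal : ∀ n → length (offDiagonal n) ≡ suc n * n
length-offDiagonal n = trans (length-cartesianProductWith _ (allFin (suc n)) (allFin n))
  (cong₂ _*_ (length-allFin (suc n)) (length-allFin n))

leftToRight : ∀ n → List (Fin (n + n) × Fin (n + n))
leftToRight n = cartesianProductWith (λ i j → i ↑ˡ n , n ↑ʳ j) (allFin n) (allFin n)

crossPairs : ∀ n → List (Fin (n + n) × Fin (n + n))
crossPairs n = leftToRight n ++ map swap (leftToRight n)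

crossPairs-unique : ∀ n → Unique (crossPairs n)
crossPairs-unique n = Uniqueₚ.++⁺ leftToRight-unique (Uniqueₚ.map⁺ swap-injective leftToRight-unique) disjoint
  where
  leftToRight-unique : Unique (leftToRight n)
  leftToRight-unique = Uniqueₚ.cartesianProductWith⁺ _
    (λ eq → Finₚ.↑ˡ-injective n _ _ (cong proj₁ eq) , Finₚ.↑ʳ-injective n _ _ (cong proj₂ eq))
    (Uniqueₚ.allFin⁺ n) (Uniqueₚ.allFin⁺ n)
  swap-injective : ∀ {x y : Fin (n + n) × Fin (n + n)} → swap x ≡ swap y → x ≡ y
  swap-injective {_ , _} {_ , _} refl = refl
  disjoint : ∀ {c} → ¬ (c ∈ leftToRight n × c ∈ map swap (leftToRight n))
  disjoint (c∈ , c∈′) with ∈ₚ.∈-cartesianProductWith⁻ _ (allFin n) (allFin n) c∈ | ∈ₚ.∈-map⁻ swap c∈′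
  ... | i , j , _ , _ , refl | c′ , c′∈ , eq with ∈ₚ.∈-cartesianProductWith⁻ _ (allFin n) (allFin n) c′∈
  ...   | i′ , j′ , _ , _ , refl = ↑ˡ≢↑ʳ i j′ (cong proj₁ eq)

length-crossPairs : ∀ n → length (crossPairs n) ≡ n * n + n * n
length-crossPairs n = trans (length-++ (leftToRight n))
  (cong₂ _+_ length-leftToRight (trans (length-map swap (leftToRight n)) length-leftToRight))
  where
  length-leftToRight : length (leftToRight n) ≡ n * n
  length-leftToRight = trans (length-cartesianProductWith _ (allFin n) (allFin n))
    (cong₂ _*_ (length-allFin n) (length-allFin n))

∈-crossPairs⁻ : ∀ {n c} → c ∈ crossPairs n → ∃₂ λ i j → c ≡ (i ↑ˡ n , n ↑ʳ j) ⊎ c ≡ (n ↑ʳ j , i ↑ˡ n)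
∈-crossPairs⁻ {n} c∈ with ∈ₚ.∈-++⁻ (leftToRight n) c∈
... | inj₁ c∈ˡ with ∈ₚ.∈-cartesianProductWith⁻ _ (allFin n) (allFin n) c∈ˡ
...   | i , j , _ , _ , refl = i , j , inj₁ refl
∈-crossPairs⁻ {n} c∈ | inj₂ c∈ʳ with ∈ₚ.∈-map⁻ swap c∈ʳ
...   | c′ , c′∈ , refl with ∈ₚ.∈-cartesianProductWith⁻ _ (allFin n) (allFin n) c′∈
...     | i , j , _ , _ , refl = i , j , inj₂ refl

-- Subsets given by characteristic functions

∈-tabulate⁺ : ∀ {n} (g : Fin n → Bool) {x} → T (g x) → x ∈ₛ Vec.tabulate g
∈-tabulate⁺ g {x} gx = Vecₚ.lookup⇒[]= x (Vec.tabulate g) (trans (Vecₚ.lookup∘tabulate g x) (Equivalence.to T-≡ gx))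

∈-tabulate⁻ : ∀ {n} (g : Fin n → Bool) {x} → x ∈ₛ Vec.tabulate g → T (g x)
∈-tabulate⁻ g {x} x∈ = Equivalence.from T-≡ (trans (sym (Vecₚ.lookup∘tabulate g x)) (Vecₚ.[]=⇒lookup x∈))

∣tabulate∣ : ∀ {n} {Pred : Fin n → Set ℓ} (P? : Decidable Pred) →
  ∣ Vec.tabulate (λ y → isYes (P? y)) ∣ ≡ ∑[ y ∈ allFin n ] 𝟙 (P? y)
∣tabulate∣ {n = zero}  P? = refl
∣tabulate∣ {n = suc n} P? with P? zero
... | yes _ = cong suc (trans (∣tabulate∣ (P? ∘ suc)) (sym (∑-tabulate Fin.suc (𝟙 ∘ P?))))
... | no  _ = trans (∣tabulate∣ (P? ∘ suc)) (sym (∑-tabulate Fin.suc (𝟙 ∘ P?)))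

image : ∀ {m n} → (Fin m → Fin n) → Subset n
image h = Vec.tabulate λ y → isYes (Finₚ.any? λ i → h i Finₚ.≟ y)

∈-image⁺ : ∀ {m n} (h : Fin m → Fin n) i → h i ∈ₛ image h
∈-image⁺ h i = ∈-tabulate⁺ _ (fromWitness {a? = Finₚ.any? λ j → h j Finₚ.≟ h i} (i , refl))

∈-image⁻ : ∀ {m n} (h : Fin m → Fin n) {y} → y ∈ₛ image h → ∃ λ i → h i ≡ y
∈-image⁻ h {y} y∈ = toWitness {a? = Finₚ.any? λ i → h i Finₚ.≟ y} (∈-tabulate⁻ _ y∈)

∣image∣ : ∀ {m n} (h : Fin m → Fin n) → (∀ {i j} → h i ≡ h j → i ≡ j) → ∣ image h ∣ ≡ m
∣image∣ {m} {n} h h-injective = begin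
  ∣ image h ∣                                           ≡⟨ ∣tabulate∣ (λ y → Finₚ.any? λ i → h i Finₚ.≟ y) ⟩
  ∑[ y ∈ allFin n ] 𝟙 (Finₚ.any? λ i → h i Finₚ.≟ y)   ≡⟨ ∑-cong (allFin n) #preimages ⟩
  ∑[ y ∈ allFin n ] ∑[ i ∈ allFin m ] 𝟙 (h i Finₚ.≟ y) ≡⟨ ∑-comm (allFin n) (allFin m) _ ⟩
  ∑[ i ∈ allFin m ] ∑[ y ∈ allFin n ] 𝟙 (h i Finₚ.≟ y) ≡⟨ ∑-cong (allFin m) (∑-𝟙≟ ∘ h) ⟩
  ∑[ i ∈ allFin m ] 1                                   ≡⟨ ∑-allFin-const m 1 ⟩
  m * 1                                                 ≡⟨ *-identityʳ m ⟩
  m                                                     ∎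
  where
  open ≡-Reasoning
  #preimages : ∀ y → 𝟙 (Finₚ.any? λ i → h i Finₚ.≟ y) ≡ ∑[ i ∈ allFin m ] 𝟙 (h i Finₚ.≟ y)
  #preimages y with Finₚ.any? (λ i → h i Finₚ.≟ y)
  ... | yes (i₀ , refl) = sym (begin
    ∑[ i ∈ allFin m ] 𝟙 (h i Finₚ.≟ h i₀)
      ≡⟨ ∑-cong (allFin m) (λ i → 𝟙-cong (h i Finₚ.≟ h i₀) (i Finₚ.≟ i₀) (mk⇔ h-injective (cong h))) ⟩
    ∑[ i ∈ allFin m ] 𝟙 (i Finₚ.≟ i₀)
      ≡⟨ ∑-cong (allFin m) (λ i → *-identityʳ (𝟙 (i Finₚ.≟ i₀))) ⟨
    ∑[ i ∈ allFin m ] (𝟙 (i Finₚ.≟ i₀) * 1)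
      ≡⟨ ∑-δ i₀ (λ _ → 1) ⟩
    1 ∎)
  ... | no ∄i = sym (begin
    ∑[ i ∈ allFin m ] 𝟙 (h i Finₚ.≟ y) ≡⟨ ∑-cong (allFin m) (λ i → 𝟙-no (h i Finₚ.≟ y) (∄i ∘ (i ,_))) ⟩
    ∑[ i ∈ allFin m ] 0                ≡⟨ ∑-allFin-const m 0 ⟩
    m * 0                              ≡⟨ *-zeroʳ m ⟩
    0                                  ∎)

-- The bipartite hedgehog

*+-injective : ∀ {d} .{{_ : NonZero d}} {i i′ j j′} → j < d → j′ < d →
  i * d + j ≡ i′ * d + j′ → i ≡ i′ × j ≡ j′
*+-injective {d} {i} {i′} {j} {j′} j<d j′<d eq = i≡i′ , j≡j′
  where
  remainder : ∀ {a b} → b < d → (a * d + b) % d ≡ b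
  remainder {a} {b} b<d = trans (cong (_% d) (+-comm (a * d) b)) (trans ([m+kn]%n≡m%n b a d) (m<n⇒m%n≡m b<d))
  j≡j′ : j ≡ j′
  j≡j′ = trans (sym (remainder {i} j<d)) (trans (cong (_% d) eq) (remainder {i′} j′<d))
  i≡i′ : i ≡ i′
  i≡i′ = *-cancelʳ-≡ i i′ d (+-cancelʳ-≡ j (i * d) (i′ * d) (trans eq (cong (i′ * d +_) (sym j≡j′))))

*+<* : ∀ {d i j} → i < d → j < d → i * d + j < d * d
*+<* {d} {i} {j} i<d j<d = begin-strict
  i * d + j  <⟨ +-monoʳ-< (i * d) j<d ⟩
  i * d + d  ≡⟨ +-comm (i * d) d ⟩
  suc i * d  ≤⟨ *-monoˡ-≤ d i<d ⟩
  d * d      ∎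
  where open ≤-Reasoning

length≤1 : ∀ {xs : List A} {x} → Unique xs → All (_≡ x) xs → length xs ≤ 1
length≤1 []                  []                  = z≤n
length≤1 (_ ∷ [])            (_ ∷ [])            = ≤-refl
length≤1 ((y≢z ∷ _) ∷ _)     (refl ∷ refl ∷ _)   = ⊥-elim (y≢z refl)

∈-hedgehog⁺ : ∀ {k d i j} → i < d → j < d → hedgehogEdge k d i j ∈ hedgehog k d
∈-hedgehog⁺ {k} {d} {i} {j} i<d j<d =
  ∈ₚ.∈-concatMap⁺ (λ i → map (hedgehogEdge k d i) (upTo d))
    (Any.map (λ { refl → ∈ₚ.∈-map⁺ (hedgehogEdge k d i) (∈ₚ.∈-upTo⁺ j<d) }) (∈ₚ.∈-upTo⁺ i<d))

∈-hedgehog⁻ : ∀ {k d e} → e ∈ hedgehog k d → ∃₂ λ i j → i < d × j < d × e ≡ hedgehogEdge k d i j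
∈-hedgehog⁻ {k} {d} e∈ with find (∈ₚ.∈-concatMap⁻ (λ i → map (hedgehogEdge k d i) (upTo d)) {xs = upTo d} e∈)
... | i , i∈ , e∈row with ∈ₚ.∈-map⁻ (hedgehogEdge k d i) e∈row
...   | j , j∈ , refl = i , j , ∈ₚ.∈-upTo⁻ i∈ , ∈ₚ.∈-upTo⁻ j∈ , refl

inHedgehogEdge-left : ∀ k d i j → T (inHedgehogEdge k d i j i)
inHedgehogEdge-left k d i j = Equivalence.from T-∨ (inj₁ (≡⇒≡ᵇ i i refl))

inHedgehogEdge-right : ∀ k d i j → T (inHedgehogEdge k d i j (d + j))
inHedgehogEdge-right k d i j =
  Equivalence.from (T-∨ {d + j ≡ᵇ i}) (inj₂ (Equivalence.from T-∨ (inj₁ (≡⇒≡ᵇ (d + j) (d + j) refl))))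

inHedgehogEdge-copy : ∀ k d i j {t} → t < k ∸ 2 → T (inHedgehogEdge k d i j (d + d + t * (d * d) + i * d + j))
inHedgehogEdge-copy k d i j {t} t<k-2 = Equivalence.from (T-∨ {x ≡ᵇ i}) (inj₂ (Equivalence.from (T-∨ {x ≡ᵇ d + j})
  (inj₂ (Anyₚ.any⁺ (λ s → x ≡ᵇ copyIndex s) (Any.map (λ { refl → ≡⇒≡ᵇ x x refl }) (∈ₚ.∈-upTo⁺ t<k-2))))))
  where
  copyIndex : ℕ → ℕ
  copyIndex s = d + d + s * (d * d) + i * d + j
  x = copyIndex t

inHedgehogEdge⁻ : ∀ k d i j x → T (inHedgehogEdge k d i j x) →
  x ≡ i ⊎ x ≡ d + j ⊎ ∃ λ t → t < k ∸ 2 × x ≡ d + d + t * (d * d) + i * d + j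
inHedgehogEdge⁻ k d i j x member with Equivalence.to (T-∨ {x ≡ᵇ i}) member
... | inj₁ x≡i = inj₁ (≡ᵇ⇒≡ x i x≡i)
... | inj₂ rest with Equivalence.to (T-∨ {x ≡ᵇ d + j}) rest
...   | inj₁ x≡d+j = inj₂ (inj₁ (≡ᵇ⇒≡ x (d + j) x≡d+j))
...   | inj₂ copies with find (Anyₚ.any⁻ (λ t → x ≡ᵇ d + d + t * (d * d) + i * d + j) (upTo (k ∸ 2)) copies)
...     | t , t∈ , x≡copy = inj₂ (inj₂ (t , ∈ₚ.∈-upTo⁻ t∈ , ≡ᵇ⇒≡ x _ x≡copy))

∈-hedgehogEdge⁺ : ∀ k d i j {x y} → toℕ x ≡ y → T (inHedgehogEdge k d i j y) → x ∈ₛ hedgehogEdge k d i j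
∈-hedgehogEdge⁺ k d i j refl = ∈-tabulate⁺ (inHedgehogEdge k d i j ∘ toℕ)

∈-hedgehogEdge⁻ : ∀ k d i j {x} → x ∈ₛ hedgehogEdge k d i j → T (inHedgehogEdge k d i j (toℕ x))
∈-hedgehogEdge⁻ k d i j = ∈-tabulate⁻ (inHedgehogEdge k d i j ∘ toℕ)

sideVertex : ∀ k d → Fin (d + d) → Fin (hedgehogVertexCount k d)
sideVertex k d p = inject≤ p (m≤m+n (d + d) _)

sideVertex-injective : ∀ k d {p q} → sideVertex k d p ≡ sideVertex k d q → p ≡ q
sideVertex-injective k d = Finₚ.inject≤-injective _ _ _ _

left-∈ : ∀ k d (i : Fin d) j → sideVertex k d (i ↑ˡ d) ∈ₛ hedgehogEdge k d (toℕ i) j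
left-∈ k d i j = ∈-hedgehogEdge⁺ k d (toℕ i) j (trans (Finₚ.toℕ-inject≤ (i ↑ˡ d) _) (Finₚ.toℕ-↑ˡ i d))
  (inHedgehogEdge-left k d (toℕ i) j)

right-∈ : ∀ k d i (j : Fin d) → sideVertex k d (d ↑ʳ j) ∈ₛ hedgehogEdge k d i (toℕ j)
right-∈ k d i j = ∈-hedgehogEdge⁺ k d i (toℕ j) (trans (Finₚ.toℕ-inject≤ (d ↑ʳ j) _) (Finₚ.toℕ-↑ʳ d j))
  (inHedgehogEdge-right k d i (toℕ j))

sideVertex-covered : ∀ k d₁ (p : Fin (suc d₁ + suc d₁)) →
  ∃₂ λ (i j : Fin (suc d₁)) → sideVertex k (suc d₁) p ∈ₛ hedgehogEdge k (suc d₁) (toℕ i) (toℕ j)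
sideVertex-covered k d₁ p with splitAt (suc d₁) p in eq
... | inj₁ i = i , zero , subst (λ p → sideVertex k (suc d₁) p ∈ₛ _) (Finₚ.splitAt⁻¹-↑ˡ eq) (left-∈ k (suc d₁) i 0)
... | inj₂ j = zero , j , subst (λ p → sideVertex k (suc d₁) p ∈ₛ _) (Finₚ.splitAt⁻¹-↑ʳ eq) (right-∈ k (suc d₁) 0 j)

module Degeneracy (k₃ d₁ : ℕ) where

  k d : ℕ
  k = 3 + k₃
  d = suc d₁

  -- Vertex (i , j) of the first copy of [d]²; it lies on the edge (i , j) only.
  privateIndex : ℕ → ℕ → ℕ
  privateIndex i j = d + d + (i * d + j)

  privateIndex< : ∀ {i j} → i < d → j < d → privateIndex i j < hedgehogVertexCount k d
  privateIndex< i<d j<d = +-monoʳ-< (d + d) (<-≤-trans (*+<* i<d j<d) (m≤m+n (d * d) _))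

  privateVertex : ∀ {i j} → i < d → j < d → Fin (hedgehogVertexCount k d)
  privateVertex i<d j<d = fromℕ< (privateIndex< i<d j<d)

  toℕ-privateVertex : ∀ {i j} (i<d : i < d) (j<d : j < d) → toℕ (privateVertex i<d j<d) ≡ privateIndex i j
  toℕ-privateVertex i<d j<d = Finₚ.toℕ-fromℕ< (privateIndex< i<d j<d)

  privateVertex-∈ : ∀ {i j} (i<d : i < d) (j<d : j < d) → privateVertex i<d j<d ∈ₛ hedgehogEdge k d i j
  privateVertex-∈ {i} {j} i<d j<d = ∈-hedgehogEdge⁺ k d i j (begin
      toℕ (privateVertex i<d j<d)      ≡⟨ toℕ-privateVertex i<d j<d ⟩
      d + d + (i * d + j)              ≡⟨ +-assoc (d + d) (i * d) j ⟨
      d + d + i * d + j                ≡⟨ cong (λ n → n + i * d + j) (+-identityʳ (d + d)) ⟨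
      d + d + 0 * (d * d) + i * d + j  ∎)
    (inHedgehogEdge-copy k d i j (s≤s z≤n))
    where open ≡-Reasoning

  d+d≤privateVertex : ∀ {i j} (i<d : i < d) (j<d : j < d) → d + d ≤ toℕ (privateVertex i<d j<d)
  d+d≤privateVertex i<d j<d = ≤-trans (m≤m+n (d + d) _) (≤-reflexive (sym (toℕ-privateVertex i<d j<d)))

  privateVertex-unique : ∀ {i j i′ j′} (i<d : i < d) (j<d : j < d) → i′ < d → j′ < d →
    privateVertex i<d j<d ∈ₛ hedgehogEdge k d i′ j′ → i′ ≡ i × j′ ≡ j
  privateVertex-unique {i} {j} {i′} {j′} i<d j<d i′<d j′<d v∈
    with inHedgehogEdge⁻ k d i′ j′ (toℕ (privateVertex i<d j<d)) (∈-hedgehogEdge⁻ k d i′ j′ v∈)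
  ... | inj₁ v≡i′ =
    ⊥-elim (<⇒≱ (<-≤-trans i′<d (m≤m+n d d)) (subst (d + d ≤_) v≡i′ (d+d≤privateVertex i<d j<d)))
  ... | inj₂ (inj₁ v≡d+j′) =
    ⊥-elim (<⇒≱ (+-monoʳ-< d j′<d) (subst (d + d ≤_) v≡d+j′ (d+d≤privateVertex i<d j<d)))
  ... | inj₂ (inj₂ (zero , _ , v≡copy)) = Product.map sym sym (*+-injective j<d j′<d (+-cancelˡ-≡ (d + d) _ _ (begin
    d + d + (i * d + j)               ≡⟨ toℕ-privateVertex i<d j<d ⟨
    toℕ (privateVertex i<d j<d)       ≡⟨ v≡copy ⟩
    d + d + 0 * (d * d) + i′ * d + j′ ≡⟨ cong (λ n → n + i′ * d + j′) (+-identityʳ (d + d)) ⟩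
    d + d + i′ * d + j′               ≡⟨ +-assoc (d + d) (i′ * d) j′ ⟩
    d + d + (i′ * d + j′)             ∎)))
    where open ≡-Reasoning
  ... | inj₂ (inj₂ (suc t , _ , v≡copy)) = ⊥-elim (<-irrefl refl (begin-strict
    toℕ (privateVertex i<d j<d)            ≡⟨ toℕ-privateVertex i<d j<d ⟩
    d + d + (i * d + j)                    <⟨ +-monoʳ-< (d + d) (*+<* i<d j<d) ⟩
    d + d + d * d                          ≤⟨ +-monoʳ-≤ (d + d) (m≤m+n (d * d) (t * (d * d))) ⟩
    d + d + suc t * (d * d)                ≤⟨ ≤-trans (m≤m+n _ (i′ * d)) (m≤m+n _ j′) ⟩
    d + d + suc t * (d * d) + i′ * d + j′  ≡⟨ v≡copy ⟨
    toℕ (privateVertex i<d j<d)            ∎))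
    where open ≤-Reasoning

  degree-privateVertex : ∀ {i j F} (i<d : i < d) (j<d : j < d) → All (_∈ hedgehog k d) F → Unique F →
    degree F (privateVertex i<d j<d) ≤ 1
  degree-privateVertex {i} {j} {F} i<d j<d F⊆H F-unique =
    length≤1 (Uniqueₚ.filter⁺ (v ∈?_) F-unique) (All.tabulate ownEdge)
    where
    v = privateVertex i<d j<d
    ownEdge : ∀ {e} → e ∈ filter (v ∈?_) F → e ≡ hedgehogEdge k d i j
    ownEdge e∈ with e∈F , v∈e ← ∈ₚ.∈-filter⁻ (v ∈?_) e∈
               with i′ , j′ , i′<d , j′<d , refl ← ∈-hedgehog⁻ {k} {d} (All.lookup F⊆H e∈F)
               with refl , refl ← privateVertex-unique i<d j<d i′<d j′<d v∈e = refl

  hedgehog-degenerate : DegenerateAtMost (hedgehog k d) 1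
  hedgehog-degenerate S []      _                   (v , v∈S) = v , v∈S , z≤n
  hedgehog-degenerate S (e ∷ F) (F⊆H , F-unique , F⊆S) _
    with i , j , i<d , j<d , refl ← ∈-hedgehog⁻ {k} {d} (All.head F⊆H) =
    privateVertex i<d j<d , All.head F⊆S (privateVertex-∈ i<d j<d) , degree-privateVertex i<d j<d F⊆H F-unique

  e₀₀ : Subset (hedgehogVertexCount k d)
  e₀₀ = hedgehogEdge k d 0 0

  single-edge : IsSubhypergraph (hedgehog k d) e₀₀ (e₀₀ ∷ [])
  single-edge = (∈-hedgehog⁺ {k} {d} (s≤s z≤n) (s≤s z≤n) ∷ []) , ([] ∷ []) , (id ∷ [])

  hedgehog-degenerate⇒1≤ : ∀ D → DegenerateAtMost (hedgehog k d) D → 1 ≤ D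
  hedgehog-degenerate⇒1≤ D degenerate
    with v , v∈e , deg≤D ← degenerate e₀₀ (e₀₀ ∷ []) single-edge (sideVertex k d (zero ↑ˡ d) , left-∈ k d zero 0) =
    ≤-trans (≤-reflexive (sym (trans (length-filter (v ∈?_) (e₀₀ ∷ [])) (cong (_+ 0) (𝟙-yes (v ∈? e₀₀) v∈e)))))
            deg≤D

  hedgehog-degeneracy : DegeneracyIs (hedgehog k d) 1
  hedgehog-degeneracy = hedgehog-degenerate , hedgehog-degenerate⇒1≤

-- The random construction

module RandomConstruction (k₁ M r₁ d₁ : ℕ) where

  k r d V : ℕ
  k = suc k₁
  r = suc r₁
  d = suc d₁
  V = k * M

  Vertex Tuple Colouring Biclique : Set
  Vertex    = Fin V
  Tuple     = Vec (Fin M) k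
  Colouring = Vec (Fin r) (V * V)
  Biclique  = Vec Vertex (d + d)

  tuples : List Tuple
  tuples = vectors M k

  colourings : List Colouring
  colourings = vectors r (V * V)

  bicliques : List Biclique
  bicliques = vectors V (d + d)

  tupleVertex : Tuple → Fin k → Vertex
  tupleVertex t i = combine i (lookup t i)

  block : Vertex → Fin k
  block u = proj₁ (remQuot {k} M u)

  index : Vertex → Fin M
  index u = proj₂ (remQuot {k} M u)

  block-tupleVertex : ∀ t i → block (tupleVertex t i) ≡ i
  block-tupleVertex t i = cong proj₁ (Finₚ.remQuot-combine i (lookup t i))

  index-tupleVertex : ∀ t i → index (tupleVertex t i) ≡ lookup t i
  index-tupleVertex t i = cong proj₂ (Finₚ.remQuot-combine i (lookup t i))

  tupleVertex-injective : ∀ t {i j} → tupleVertex t i ≡ tupleVertex t j → i ≡ j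
  tupleVertex-injective t {i} {j} eq = proj₁ (Finₚ.combine-injective i (lookup t i) j (lookup t j) eq)

  -- Ordered pairs are coloured independently, which is why a clique of k vertices imposes k(k-1)
  -- constraints and a biclique with sides of size d imposes 2d².
  Red : Colouring → Vertex → Vertex → Set
  Red f u v = lookup f (combine u v) ≡ zero

  redAlong : ∀ {X : Set} → List (X × X) → (X → Vertex) → List (Constraint r (V * V))
  redAlong ps g = map (λ (x , y) → combine (g x) (g y) , zero) ps

  #solutions-redAlong : ∀ {X : Set} (ps : List (X × X)) (g : X → Vertex) → (∀ {x y} → g x ≡ g y → x ≡ y) →
    Unique ps → #solutions (redAlong ps g) * r ^ length ps ≡ r ^ (V * V)
  #solutions-redAlong ps g g-injective unique = subst (λ n → #solutions (redAlong ps g) * r ^ n ≡ r ^ (V * V))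
    (length-map _ ps)
    (#solutions-* (redAlong ps g) (subst Unique (map-∘ ps) (Uniqueₚ.map⁺ pair-injective unique)))
    where
    pair-injective : ∀ {c c′} → combine (g (proj₁ c)) (g (proj₂ c)) ≡ combine (g (proj₁ c′)) (g (proj₂ c′)) →
                     c ≡ c′
    pair-injective {_ , _} {_ , _} eq with gx≡gx′ , gy≡gy′ ← Finₚ.combine-injective _ _ _ _ eq =
      cong₂ _,_ (g-injective gx≡gx′) (g-injective gy≡gy′)

  satisfies-redAlong⁻ : ∀ {X : Set} {ps : List (X × X)} {g} f {x y} →
    Satisfies (redAlong ps g) f → (x , y) ∈ ps → Red f (g x) (g y)
  satisfies-redAlong⁻ f sat xy∈ = All.lookup (Allₚ.map⁻ sat) xy∈

  satisfies-redAlong⁺ : ∀ {X : Set} {ps : List (X × X)} {g} f →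
    (∀ {x y} → (x , y) ∈ ps → Red f (g x) (g y)) → Satisfies (redAlong ps g) f
  satisfies-redAlong⁺ f red = Allₚ.map⁺ (All.tabulate λ {c} → red {proj₁ c} {proj₂ c})

  cliqueConstraints : Tuple → List (Constraint r (V * V))
  cliqueConstraints t = redAlong (offDiagonal k₁) (tupleVertex t)

  RedClique : Colouring → Tuple → Set
  RedClique f t = Satisfies (cliqueConstraints t) f

  redClique? : ∀ f t → Dec (RedClique f t)
  redClique? f t = satisfies? (cliqueConstraints t) f

  Occurs : Vertex → Tuple → Set
  Occurs u t = ∃ λ l → tupleVertex t l ≡ u

  occurs⇒anchored : ∀ t {u} → Occurs u t → lookup t (block u) ≡ index u
  occurs⇒anchored t (l , refl) = trans (cong (lookup t) (block-tupleVertex t l)) (sym (index-tupleVertex t l))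

  occurs-block-injective : ∀ t {u v} → Occurs u t → Occurs v t → block u ≡ block v → u ≡ v
  occurs-block-injective t (l , refl) (l′ , refl) eq =
    cong (tupleVertex t) (trans (sym (block-tupleVertex t l)) (trans eq (block-tupleVertex t l′)))

  redClique⇒red : ∀ f t {u v} → RedClique f t → Occurs u t → Occurs v t → u ≢ v → Red f u v
  redClique⇒red f t clique (l , refl) (l′ , refl) u≢v =
    satisfies-redAlong⁻ f clique (∈-offDiagonal {i = l} {l′} λ { refl → u≢v refl })

  #solutions-cliqueConstraints : ∀ t → #solutions (cliqueConstraints t) * r ^ (k * k₁) ≡ r ^ (V * V)
  #solutions-cliqueConstraints t = subst (λ n → #solutions (cliqueConstraints t) * r ^ n ≡ r ^ (V * V))
    (length-offDiagonal k₁)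
    (#solutions-redAlong (offDiagonal k₁) (tupleVertex t) (tupleVertex-injective t) (offDiagonal-unique k₁))

  left right : Biclique → Fin d → Vertex
  left  w i = lookup w (i ↑ˡ d)
  right w j = lookup w (d ↑ʳ j)

  Admissible : Biclique → Set
  Admissible w = (∀ p q → lookup w p ≡ lookup w q → p ≡ q) × block (left w zero) ≢ block (right w zero)

  admissible? : ∀ w → Dec (Admissible w)
  admissible? w = Finₚ.all? (λ p → Finₚ.all? λ q → (lookup w p Finₚ.≟ lookup w q) →-dec (p Finₚ.≟ q))
                  ×-dec ¬? (block (left w zero) Finₚ.≟ block (right w zero))

  bicliqueConstraints : Biclique → List (Constraint r (V * V))
  bicliqueConstraints w = redAlong (crossPairs d) (lookup w)

  RedBiclique : Colouring → Biclique → Set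
  RedBiclique f w = Admissible w × Satisfies (bicliqueConstraints w) f

  redBiclique? : ∀ f w → Dec (RedBiclique f w)
  redBiclique? f w = admissible? w ×-dec satisfies? (bicliqueConstraints w) f

  redBiclique⁺ : ∀ f w → Admissible w → (∀ i j → Red f (left w i) (right w j) × Red f (right w j) (left w i)) →
    RedBiclique f w
  redBiclique⁺ f w admissible red = admissible , satisfies-redAlong⁺ f crossRed
    where
    crossRed : ∀ {p q} → (p , q) ∈ crossPairs d → Red f (lookup w p) (lookup w q)
    crossRed pq∈ with ∈-crossPairs⁻ {d} pq∈
    ... | i , j , inj₁ refl = proj₁ (red i j)
    ... | i , j , inj₂ refl = proj₂ (red i j)

  ∑-redBiclique : ∀ w → ∑[ f ∈ colourings ] 𝟙 (redBiclique? f w) * r ^ (d * d + d * d) ≤ r ^ (V * V)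
  ∑-redBiclique w = bound (admissible? w)
    where
    open ≡-Reasoning
    Q = r ^ (d * d + d * d)
    bound : Dec (Admissible w) → ∑[ f ∈ colourings ] 𝟙 (redBiclique? f w) * Q ≤ r ^ (V * V)
    bound (no ¬admissible) = ≤-trans (≤-reflexive (begin
      ∑[ f ∈ colourings ] 𝟙 (redBiclique? f w) * Q
        ≡⟨ cong (_* Q) (∑-cong colourings λ f → 𝟙-no (redBiclique? f w) (¬admissible ∘ proj₁)) ⟩
      ∑[ f ∈ colourings ] 0 * Q
        ≡⟨ cong (_* Q) (trans (∑-const colourings 0) (*-zeroʳ (length colourings))) ⟩
      0 ∎)) z≤n
    bound (yes admissible@(distinct , _)) = ≤-reflexive (begin
      ∑[ f ∈ colourings ] 𝟙 (redBiclique? f w) * Q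
        ≡⟨ cong (_* Q) (∑-cong colourings λ f →
             𝟙-cong (redBiclique? f w) (satisfies? (bicliqueConstraints w) f) (mk⇔ proj₂ (admissible ,_))) ⟩
      #solutions (bicliqueConstraints w) * Q
        ≡⟨ cong (λ n → #solutions (bicliqueConstraints w) * r ^ n) (length-crossPairs d) ⟨
      #solutions (bicliqueConstraints w) * r ^ length (crossPairs d)
        ≡⟨ #solutions-redAlong (crossPairs d) (lookup w) (distinct _ _) (crossPairs-unique d) ⟩
      r ^ (V * V) ∎)

  -- A tuple satisfies anchors w iff it contains both left w zero and right w zero.
  anchors : Biclique → List (Constraint M k)
  anchors w = (block (left w zero) , index (left w zero)) ∷ (block (right w zero) , index (right w zero)) ∷ []

  #solutions-anchors : ∀ w → Admissible w → #solutions (anchors w) * M ^ 2 ≡ M ^ k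
  #solutions-anchors w (_ , blocks≢) = #solutions-* (anchors w) ((blocks≢ ∷ []) ∷ [] ∷ [])

  spoilers : Colouring → Tuple → ℕ
  spoilers f t = ∑[ w ∈ bicliques ] (𝟙 (redBiclique? f w) * 𝟙 (satisfies? (anchors w) t))

  Survives : Colouring → Tuple → Set
  Survives f t = RedClique f t × spoilers f t ≡ 0

  survives? : ∀ f t → Dec (Survives f t)
  survives? f t = redClique? f t ×-dec (spoilers f t ≟ 0)

  survivors : Colouring → List Tuple
  survivors f = filter (survives? f) tuples

  #redCliques #redBicliques : Colouring → ℕ
  #redCliques   f = ∑[ t ∈ tuples ] 𝟙 (redClique? f t)
  #redBicliques f = ∑[ w ∈ bicliques ] 𝟙 (redBiclique? f w)

  ∑-spoilers : ∀ f → ∑ tuples (spoilers f) * M ^ 2 ≡ #redBicliques f * M ^ k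
  ∑-spoilers f = begin
    ∑ tuples (spoilers f) * M ^ 2
      ≡⟨ cong (_* M ^ 2) (∑-comm tuples bicliques λ t w → 𝟙 (redBiclique? f w) * 𝟙 (satisfies? (anchors w) t)) ⟩
    ∑[ w ∈ bicliques ] ∑[ t ∈ tuples ] (𝟙 (redBiclique? f w) * 𝟙 (satisfies? (anchors w) t)) * M ^ 2
      ≡⟨ cong (_* M ^ 2) (∑-cong bicliques λ w →
           *-distribˡ-∑ (𝟙 (redBiclique? f w)) tuples (𝟙 ∘ satisfies? (anchors w))) ⟨
    ∑[ w ∈ bicliques ] (𝟙 (redBiclique? f w) * #solutions (anchors w)) * M ^ 2
      ≡⟨ *-distribʳ-∑ (M ^ 2) bicliques _ ⟩
    ∑[ w ∈ bicliques ] (𝟙 (redBiclique? f w) * #solutions (anchors w) * M ^ 2)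
      ≡⟨ ∑-cong bicliques (λ w → anchoredAt w (redBiclique? f w)) ⟩
    ∑[ w ∈ bicliques ] (𝟙 (redBiclique? f w) * M ^ k)
      ≡⟨ *-distribʳ-∑ (M ^ k) bicliques _ ⟨
    #redBicliques f * M ^ k ∎
    where
    open ≡-Reasoning
    anchoredAt : ∀ w (red? : Dec (RedBiclique f w)) → 𝟙 red? * #solutions (anchors w) * M ^ 2 ≡ 𝟙 red? * M ^ k
    anchoredAt w (yes (admissible , _)) =
      trans (*-assoc 1 (#solutions (anchors w)) (M ^ 2)) (cong (1 *_) (#solutions-anchors w admissible))
    anchoredAt w (no _)                 = refl

  deletion : ∀ f → M ^ 2 * #redCliques f ≤ M ^ 2 * length (survivors f) + M ^ k * #redBicliques f
  deletion f = begin
    M ^ 2 * #redCliques f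
      ≤⟨ *-monoʳ-≤ (M ^ 2) (∑-mono-≤ tuples λ t → 𝟙≤𝟙[×≡0]+ (redClique? f t) (spoilers f t)) ⟩
    M ^ 2 * ∑[ t ∈ tuples ] (𝟙 (survives? f t) + spoilers f t)
      ≡⟨ cong (M ^ 2 *_) (∑-distrib-+ tuples (𝟙 ∘ survives? f) (spoilers f)) ⟩
    M ^ 2 * (∑[ t ∈ tuples ] 𝟙 (survives? f t) + ∑ tuples (spoilers f))
      ≡⟨ cong (λ n → M ^ 2 * (n + ∑ tuples (spoilers f))) (length-filter (survives? f) tuples) ⟨
    M ^ 2 * (length (survivors f) + ∑ tuples (spoilers f))
      ≡⟨ *-distribˡ-+ (M ^ 2) (length (survivors f)) _ ⟩
    M ^ 2 * length (survivors f) + M ^ 2 * ∑ tuples (spoilers f)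
      ≡⟨ cong (M ^ 2 * length (survivors f) +_) (trans (*-comm (M ^ 2) _) (trans (∑-spoilers f) (*-comm _ (M ^ k)))) ⟩
    M ^ 2 * length (survivors f) + M ^ k * #redBicliques f ∎
    where open ≤-Reasoning

  ∑-#redCliques : ∑ colourings #redCliques * r ^ (k * k₁) ≡ M ^ k * r ^ (V * V)
  ∑-#redCliques = begin
    ∑ colourings #redCliques * r ^ (k * k₁)
      ≡⟨ cong (_* r ^ (k * k₁)) (∑-comm colourings tuples λ f t → 𝟙 (redClique? f t)) ⟩
    ∑[ t ∈ tuples ] #solutions (cliqueConstraints t) * r ^ (k * k₁)
      ≡⟨ *-distribʳ-∑ (r ^ (k * k₁)) tuples _ ⟩
    ∑[ t ∈ tuples ] (#solutions (cliqueConstraints t) * r ^ (k * k₁))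
      ≡⟨ ∑-cong tuples #solutions-cliqueConstraints ⟩
    ∑[ t ∈ tuples ] (r ^ (V * V))
      ≡⟨ ∑-vectors-const M k (r ^ (V * V)) ⟩
    M ^ k * r ^ (V * V) ∎
    where open ≡-Reasoning

  ∑-#redBicliques : ∑ colourings #redBicliques * r ^ (d * d + d * d) ≤ V ^ (d + d) * r ^ (V * V)
  ∑-#redBicliques = begin
    ∑ colourings #redBicliques * r ^ (d * d + d * d)
      ≡⟨ cong (_* r ^ (d * d + d * d)) (∑-comm colourings bicliques λ f w → 𝟙 (redBiclique? f w)) ⟩
    ∑[ w ∈ bicliques ] ∑[ f ∈ colourings ] 𝟙 (redBiclique? f w) * r ^ (d * d + d * d)
      ≡⟨ *-distribʳ-∑ (r ^ (d * d + d * d)) bicliques _ ⟩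
    ∑[ w ∈ bicliques ] (∑[ f ∈ colourings ] 𝟙 (redBiclique? f w) * r ^ (d * d + d * d))
      ≤⟨ ∑-mono-≤ bicliques ∑-redBiclique ⟩
    ∑[ w ∈ bicliques ] (r ^ (V * V))
      ≡⟨ ∑-vectors-const V (d + d) (r ^ (V * V)) ⟩
    V ^ (d + d) * r ^ (V * V) ∎
    where open ≤-Reasoning

  ∑-deletion : M ^ 2 * ∑ colourings #redCliques ≤
               M ^ 2 * ∑[ f ∈ colourings ] length (survivors f) + M ^ k * ∑ colourings #redBicliques
  ∑-deletion = begin
    M ^ 2 * ∑ colourings #redCliques
      ≡⟨ *-distribˡ-∑ (M ^ 2) colourings #redCliques ⟩
    ∑[ f ∈ colourings ] (M ^ 2 * #redCliques f)
      ≤⟨ ∑-mono-≤ colourings deletion ⟩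
    ∑[ f ∈ colourings ] (M ^ 2 * length (survivors f) + M ^ k * #redBicliques f)
      ≡⟨ ∑-distrib-+ colourings _ _ ⟩
    ∑[ f ∈ colourings ] (M ^ 2 * length (survivors f)) + ∑[ f ∈ colourings ] (M ^ k * #redBicliques f)
      ≡⟨ cong₂ _+_ (*-distribˡ-∑ (M ^ 2) colourings (length ∘ survivors))
                   (*-distribˡ-∑ (M ^ k) colourings #redBicliques) ⟨
    M ^ 2 * ∑[ f ∈ colourings ] length (survivors f) + M ^ k * ∑ colourings #redBicliques ∎
    where open ≤-Reasoning

  good-colouring : 1 ≤ M → 2 * r ^ (k * k₁) * V ^ (d + d) ≤ M ^ 2 * r ^ (d * d + d * d) →
    ∃ λ f → M ^ k ≤ 2 * r ^ (k * k₁) * length (survivors f)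
  good-colouring M≥1 sparse = ∑-≤⇒∃-≤ colourings (λ _ → M ^ k) (λ f → 2 * R * length (survivors f))
    (subst (0 <_) (sym (length-vectors r (V * V))) (m^n>0 r (V * V))) average
    where
    R = r ^ (k * k₁)
    Q = r ^ (d * d + d * d)
    N = r ^ (V * V)
    S = ∑[ f ∈ colourings ] length (survivors f)
    instance
      _ : NonZero (M ^ 2)
      _ = m^n≢0 M 2 {{>-nonZero M≥1}}
      _ : NonZero Q
      _ = m^n≢0 r (d * d + d * d)

    bicliques-bound : 2 * R * ∑ colourings #redBicliques ≤ M ^ 2 * N
    bicliques-bound = *-cancelʳ-≤ _ _ Q (begin
      2 * R * ∑ colourings #redBicliques * Q   ≡⟨ *-assoc (2 * R) _ Q ⟩
      2 * R * (∑ colourings #redBicliques * Q) ≤⟨ *-monoʳ-≤ (2 * R) ∑-#redBicliques ⟩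
      2 * R * (V ^ (d + d) * N)                ≡⟨ *-assoc (2 * R) (V ^ (d + d)) N ⟨
      2 * R * V ^ (d + d) * N                  ≤⟨ *-monoˡ-≤ N sparse ⟩
      M ^ 2 * Q * N                            ≡⟨ *-rearrange (M ^ 2) Q N ⟩
      M ^ 2 * N * Q                            ∎)
      where
      open ≤-Reasoning
      *-rearrange : ∀ a b c → a * b * c ≡ a * c * b
      *-rearrange = solve-∀

    doubled : M ^ 2 * (M ^ k * N) + M ^ 2 * (M ^ k * N) ≤ M ^ 2 * (2 * R * S) + M ^ 2 * (M ^ k * N)
    doubled = begin
      M ^ 2 * (M ^ k * N) + M ^ 2 * (M ^ k * N)
        ≡⟨ cong (λ n → M ^ 2 * n + M ^ 2 * n) ∑-#redCliques ⟨
      M ^ 2 * (∑ colourings #redCliques * R) + M ^ 2 * (∑ colourings #redCliques * R)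
        ≡⟨ double (M ^ 2) (∑ colourings #redCliques) R ⟩
      2 * R * (M ^ 2 * ∑ colourings #redCliques)
        ≤⟨ *-monoʳ-≤ (2 * R) ∑-deletion ⟩
      2 * R * (M ^ 2 * S + M ^ k * ∑ colourings #redBicliques)
        ≡⟨ distribute (2 * R) (M ^ 2) S (M ^ k) (∑ colourings #redBicliques) ⟩
      M ^ 2 * (2 * R * S) + M ^ k * (2 * R * ∑ colourings #redBicliques)
        ≤⟨ +-monoʳ-≤ (M ^ 2 * (2 * R * S)) (*-monoʳ-≤ (M ^ k) bicliques-bound) ⟩
      M ^ 2 * (2 * R * S) + M ^ k * (M ^ 2 * N)
        ≡⟨ cong (M ^ 2 * (2 * R * S) +_) (swap-outer (M ^ k) (M ^ 2) N) ⟩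
      M ^ 2 * (2 * R * S) + M ^ 2 * (M ^ k * N) ∎
      where
      open ≤-Reasoning
      double : ∀ a b c → a * (b * c) + a * (b * c) ≡ 2 * c * (a * b)
      double = solve-∀
      distribute : ∀ a b c d e → a * (b * c + d * e) ≡ b * (a * c) + d * (a * e)
      distribute = solve-∀
      swap-outer : ∀ a b c → a * (b * c) ≡ b * (a * c)
      swap-outer = solve-∀

    average : ∑[ f ∈ colourings ] (M ^ k) ≤ ∑[ f ∈ colourings ] (2 * R * length (survivors f))
    average = begin
      ∑[ f ∈ colourings ] (M ^ k)                    ≡⟨ ∑-vectors-const r (V * V) (M ^ k) ⟩
      N * M ^ k                                    ≡⟨ *-comm N (M ^ k) ⟩
      M ^ k * N                                    ≤⟨ *-cancelˡ-≤ (M ^ 2) (+-cancelʳ-≤ _ _ _ doubled) ⟩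
      2 * R * S                                    ≡⟨ *-distribˡ-∑ (2 * R) colourings (length ∘ survivors) ⟩
      ∑[ f ∈ colourings ] (2 * R * length (survivors f)) ∎
      where open ≤-Reasoning

  module SurvivorGraph {n} (V≤n : V ≤ n) (f : Colouring) where

    embed : Vertex → Fin n
    embed u = inject≤ u V≤n

    embed-injective : ∀ {u v} → embed u ≡ embed v → u ≡ v
    embed-injective = Finₚ.inject≤-injective _ _ _ _

    edgeOf : Tuple → Subset n
    edgeOf t = image (embed ∘ tupleVertex t)

    embed∈edgeOf⇒occurs : ∀ t {u} → embed u ∈ₛ edgeOf t → Occurs u t
    embed∈edgeOf⇒occurs t u∈ with l , eq ← ∈-image⁻ (embed ∘ tupleVertex t) u∈ = l , embed-injective eq

    edgeOf-injective : ∀ {t t′} → edgeOf t ≡ edgeOf t′ → t ≡ t′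
    edgeOf-injective {t} {t′} eq = begin
      t                          ≡⟨ Vecₚ.tabulate∘lookup t ⟨
      Vec.tabulate (lookup t)    ≡⟨ Vecₚ.tabulate-cong sameEntry ⟩
      Vec.tabulate (lookup t′)   ≡⟨ Vecₚ.tabulate∘lookup t′ ⟩
      t′                         ∎
      where
      open ≡-Reasoning
      sameEntry : ∀ i → lookup t i ≡ lookup t′ i
      sameEntry i
        with l , eq′ ← embed∈edgeOf⇒occurs t′
                         (subst (embed (tupleVertex t i) ∈ₛ_) eq (∈-image⁺ (embed ∘ tupleVertex t) i))
        with refl , t′l≡ti ← Finₚ.combine-injective l (lookup t′ l) i (lookup t i) eq′ = sym t′l≡ti

    graph : Hypergraph n
    graph = map edgeOf (survivors f)

    graph-uniform : IsUniform k graph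
    graph-uniform = Allₚ.map⁺ (All.universal ∣edgeOf∣ (survivors f))
                  , Uniqueₚ.map⁺ edgeOf-injective (Uniqueₚ.filter⁺ (survives? f) (vectors-unique M k))
      where
      ∣edgeOf∣ : ∀ t → ∣ edgeOf t ∣ ≡ k
      ∣edgeOf∣ t = ∣image∣ (embed ∘ tupleVertex t) (tupleVertex-injective t ∘ embed-injective)

    numEdges-graph : numEdges graph ≡ length (survivors f)
    numEdges-graph = length-map edgeOf (survivors f)

    module _ (copy : ContainsCopy graph (hedgehog k d)) where

      φ : Fin (hedgehogVertexCount k d) → Fin n
      φ = proj₁ copy

      Host : Fin d → Fin d → Set
      Host i j = Σ Tuple λ t → Survives f t × (∀ x → x ∈ₛ hedgehogEdge k d (toℕ i) (toℕ j) → φ x ∈ₛ edgeOf t)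

      -- Opaque: otherwise conversion checking unfolds these proofs together with the edges of the
      -- hedgehog, which is prohibitively slow.
      opaque
        host : ∀ i j → Host i j
        host i j = fromImage (All.lookup (proj₂ (proj₂ copy)) (∈-hedgehog⁺ {k} {d} (Finₚ.toℕ<n i) (Finₚ.toℕ<n j)))
          where
          E : Subset (hedgehogVertexCount k d)
          E = hedgehogEdge k d (toℕ i) (toℕ j)
          fromSurvivor : ∀ {e′} → (∃ λ t → t ∈ survivors f × e′ ≡ edgeOf t) → (∀ x → x ∈ₛ E → φ x ∈ₛ e′) →
                         Host i j
          fromSurvivor (t , t∈ , refl) into = t , proj₂ (∈ₚ.∈-filter⁻ (survives? f) {xs = tuples} t∈) , into
          fromImage : Σ (Subset n) (λ e′ → e′ ∈ graph × MapsOnto φ E e′) → Host i j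
          fromImage (e′ , e′∈ , into , _) = fromSurvivor (∈ₚ.∈-map⁻ edgeOf e′∈) into

        lift : ∀ p → Σ Vertex λ u → embed u ≡ φ (sideVertex k d p)
        lift p = fromCover (sideVertex-covered k d₁ p)
          where
          fromCover : (∃₂ λ (i j : Fin d) → sideVertex k d p ∈ₛ hedgehogEdge k d (toℕ i) (toℕ j)) →
                      Σ Vertex λ u → embed u ≡ φ (sideVertex k d p)
          fromCover (i , j , side∈) =
            let t = proj₁ (host i j); l , eq = ∈-image⁻ (embed ∘ tupleVertex t) (proj₂ (proj₂ (host i j)) _ side∈)
            in tupleVertex t l , eq

      w : Biclique
      w = Vec.tabulate λ p → proj₁ (lift p)

      embed-w : ∀ p → embed (lookup w p) ≡ φ (sideVertex k d p)
      embed-w p = trans (cong embed (Vecₚ.lookup∘tabulate (λ p → proj₁ (lift p)) p)) (proj₂ (lift p))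

      hostTuple : Fin d → Fin d → Tuple
      hostTuple i j = proj₁ (host i j)

      t₀₀ : Tuple
      t₀₀ = hostTuple zero zero

      w-distinct : ∀ p q → lookup w p ≡ lookup w q → p ≡ q
      w-distinct p q eq = sideVertex-injective k d (proj₁ (proj₂ copy) (begin
        φ (sideVertex k d p) ≡⟨ embed-w p ⟨
        embed (lookup w p)   ≡⟨ cong embed eq ⟩
        embed (lookup w q)   ≡⟨ embed-w q ⟩
        φ (sideVertex k d q) ∎))
        where open ≡-Reasoning

      left≢right : ∀ i j → left w i ≢ right w j
      left≢right i j = ↑ˡ≢↑ʳ i j ∘ w-distinct _ _

      occurs-in-host : ∀ {i j} p → sideVertex k d p ∈ₛ hedgehogEdge k d (toℕ i) (toℕ j) →
                       Occurs (lookup w p) (hostTuple i j)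
      occurs-in-host {i} {j} p side∈ =
        embed∈edgeOf⇒occurs (hostTuple i j) (subst (_∈ₛ _) (sym (embed-w p)) (proj₂ (proj₂ (host i j)) _ side∈))

      left-occurs : ∀ i j → Occurs (left w i) (hostTuple i j)
      left-occurs i j = occurs-in-host (i ↑ˡ d) (left-∈ k d i (toℕ j))

      right-occurs : ∀ i j → Occurs (right w j) (hostTuple i j)
      right-occurs i j = occurs-in-host (d ↑ʳ j) (right-∈ k d (toℕ i) j)

      w-redBiclique : RedBiclique f w
      w-redBiclique = redBiclique⁺ f w (w-distinct , blocks≢) λ i j →
          redClique⇒red f (hostTuple i j) (clique i j) (left-occurs i j) (right-occurs i j) (left≢right i j)
        , redClique⇒red f (hostTuple i j) (clique i j) (right-occurs i j) (left-occurs i j) (left≢right i j ∘ sym)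
        where
        clique : ∀ i j → RedClique f (hostTuple i j)
        clique i j = proj₁ (proj₁ (proj₂ (host i j)))
        blocks≢ : block (left w zero) ≢ block (right w zero)
        blocks≢ = left≢right zero zero ∘ occurs-block-injective t₀₀ (left-occurs zero zero) (right-occurs zero zero)

      w-anchored : Satisfies (anchors w) t₀₀
      w-anchored = occurs⇒anchored t₀₀ (left-occurs zero zero) ∷ occurs⇒anchored t₀₀ (right-occurs zero zero) ∷ []

      t₀₀-spoiled : 1 ≤ spoilers f t₀₀
      t₀₀-spoiled = begin
        1
          ≡⟨ cong₂ _*_ (𝟙-yes (redBiclique? f w) w-redBiclique) (𝟙-yes (satisfies? (anchors w) t₀₀) w-anchored) ⟨
        𝟙 (redBiclique? f w) * 𝟙 (satisfies? (anchors w) t₀₀)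
          ≤⟨ ∈⇒≤∑ (λ w′ → 𝟙 (redBiclique? f w′) * 𝟙 (satisfies? (anchors w′) t₀₀)) (∈-vectors w) ⟩
        spoilers f t₀₀ ∎
        where open ≤-Reasoning

      t₀₀-unspoiled : spoilers f t₀₀ ≡ 0
      t₀₀-unspoiled = proj₂ (proj₁ (proj₂ (host zero zero)))

    hedgehog-free : ¬ ContainsCopy graph (hedgehog k d)
    hedgehog-free copy = <⇒≢ (t₀₀-spoiled copy) (sym (t₀₀-unspoiled copy))

  dense-hedgehog-free : ∀ {n} → V ≤ n → 1 ≤ M → 2 * r ^ (k * k₁) * V ^ (d + d) ≤ M ^ 2 * r ^ (d * d + d * d) →
    Σ (Hypergraph n) λ G → IsUniform k G × ¬ ContainsCopy G (hedgehog k d) × M ^ k ≤ 2 * r ^ (k * k₁) * numEdges G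
  dense-hedgehog-free {n} V≤n M≥1 sparse = fromColouring (good-colouring M≥1 sparse)
    where
    fromColouring : (∃ λ f → M ^ k ≤ 2 * r ^ (k * k₁) * length (survivors f)) →
      Σ (Hypergraph n) λ G → IsUniform k G × ¬ ContainsCopy G (hedgehog k d) × M ^ k ≤ 2 * r ^ (k * k₁) * numEdges G
    fromColouring (f , dense) =
      graph , graph-uniform , hedgehog-free , subst (λ e → M ^ k ≤ 2 * r ^ (k * k₁) * e) (sym numEdges-graph) dense
      where open SurvivorGraph V≤n f

-- Choice of parameters

^-distribʳ-* : ∀ a b n → (a * b) ^ n ≡ a ^ n * b ^ n
^-distribʳ-* a b zero    = refl
^-distribʳ-* a b (suc n) = trans (cong (a * b *_) (^-distribʳ-* a b n)) (*-interchange a b (a ^ n) (b ^ n))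

^-swap : ∀ a m n → (a ^ m) ^ n ≡ (a ^ n) ^ m
^-swap a m n = trans (^-*-assoc a m n) (trans (cong (a ^_) (*-comm m n)) (sym (^-*-assoc a n m)))

m≤m^[1+n] : ∀ m n → 1 ≤ m → m ≤ m ^ suc n
m≤m^[1+n] m n m≥1 = m≤m*n m (m ^ n) {{m^n≢0 m n {{>-nonZero m≥1}}}}

m≤2*m^[1+n] : ∀ m n → 1 ≤ m → m ≤ 2 * m ^ suc n
m≤2*m^[1+n] m n m≥1 = ≤-trans (m≤m^[1+n] m n m≥1) (m≤m+n (m ^ suc n) _)

quotient-bounds : ∀ k n .{{_ : NonZero k}} → k ≤ n → 1 ≤ n / k × k * (n / k) ≤ n × n ≤ 2 * k * (n / k)
quotient-bounds k n k≤n = M≥1 , ≤-trans (≤-reflexive (*-comm k M)) (m/n*n≤m n k) , (begin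
  n               ≡⟨ m≡m%n+[m/n]*n n k ⟩
  n % k + M * k   ≤⟨ +-monoˡ-≤ (M * k) (<⇒≤ (m%n<n n k)) ⟩
  k + M * k       ≤⟨ +-monoˡ-≤ (M * k) (m≤n*m k M {{>-nonZero M≥1}}) ⟩
  M * k + M * k   ≡⟨ double M k ⟩
  2 * k * M       ∎)
  where
  open ≤-Reasoning
  M = n / k
  M≥1 : 1 ≤ M
  M≥1 = m≥n⇒m/n>0 k≤n
  double : ∀ a b → a * b + a * b ≡ 2 * b * a
  double = solve-∀

crossing : ∀ (g : ℕ → ℕ) {n} s m → g s ≤ n → n < g (s + m) → ∃ λ q → s ≤ q × g q ≤ n × n < g (suc q)
crossing g s zero    gs≤n n<g = ⊥-elim (<⇒≱ (subst (λ x → _ < g x) (+-identityʳ s) n<g) gs≤n)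
crossing g {n} s (suc m) gs≤n n<g with n <? g (suc s)
... | yes n<g[1+s] = s , ≤-refl , gs≤n , n<g[1+s]
... | no  n≮g[1+s]
  with q , 1+s≤q , gq≤n , n<g[1+q] ← crossing g (suc s) m (≮⇒≥ n≮g[1+s]) (subst (λ x → n < g x) (+-suc s m) n<g)
  = q , <⇒≤ 1+s≤q , gq≤n , n<g[1+q]

root-bracket : ∀ d₁ {n R} → 1 ≤ R → R ^ suc d₁ ≤ n →
  ∃ λ q → R ≤ suc q × n ≤ suc q ^ suc d₁ × suc q ^ suc d₁ ≤ 2 ^ suc d₁ * n
root-bracket d₁ {n} {R} R≥1 R^d≤n = bracket (crossing (_^ d) R n R^d≤n n<[R+n]^d)
  where
  d = suc d₁
  n<[R+n]^d : n < (R + n) ^ d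
  n<[R+n]^d = <-≤-trans (m<n+m n R≥1) (m≤m^[1+n] (R + n) d₁ (≤-trans R≥1 (m≤m+n R n)))
  bracket : (∃ λ q → R ≤ q × q ^ d ≤ n × n < suc q ^ d) →
            ∃ λ q → R ≤ suc q × n ≤ suc q ^ d × suc q ^ d ≤ 2 ^ d * n
  bracket (q , R≤q , q^d≤n , n<[1+q]^d) = q , ≤-trans R≤q (n≤1+n q) , <⇒≤ n<[1+q]^d , (begin
    suc q ^ d        ≤⟨ ^-monoˡ-≤ d 1+q≤2q ⟩
    (2 * q) ^ d      ≡⟨ ^-distribʳ-* 2 q d ⟩
    2 ^ d * q ^ d    ≤⟨ *-monoʳ-≤ (2 ^ d) q^d≤n ⟩
    2 ^ d * n        ∎)
    where
    open ≤-Reasoning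
    1+q≤2q : suc q ≤ 2 * q
    1+q≤2q = subst (suc q ≤_) (cong (q +_) (sym (+-identityʳ q))) (+-monoˡ-≤ q (≤-trans R≥1 R≤q))

sparse-condition : ∀ k kk₁ d₁ M r .{{_ : NonZero r}} →
  2 * k ^ (suc d₁ + suc d₁) ≤ r → M ≤ r ^ suc d₁ → suc kk₁ ≤ suc d₁ + suc d₁ →
  2 * r ^ kk₁ * (k * M) ^ (suc d₁ + suc d₁) ≤ M ^ 2 * r ^ (suc d₁ * suc d₁ + suc d₁ * suc d₁)
sparse-condition k kk₁ d₁ M r r-large M≤r^d kk₁<2d = begin
  2 * r ^ kk₁ * (k * M) ^ (d + d)                     ≡⟨ cong (2 * r ^ kk₁ *_) (^-distribʳ-* k M (d + d)) ⟩
  2 * r ^ kk₁ * (k ^ (d + d) * M ^ (d + d))           ≡⟨ cong (λ x → 2 * r ^ kk₁ * (k ^ (d + d) * x)) M^2d ⟩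
  2 * r ^ kk₁ * (k ^ (d + d) * (M ^ 2 * M ^ (d₁ + d₁))) ≡⟨ regroup (r ^ kk₁) (k ^ (d + d)) (M ^ 2) (M ^ (d₁ + d₁)) ⟩
  2 * k ^ (d + d) * r ^ kk₁ * (M ^ 2 * M ^ (d₁ + d₁)) ≤⟨ *-mono-≤ (*-monoˡ-≤ (r ^ kk₁) r-large)
                                                                  (*-monoʳ-≤ (M ^ 2) (^-monoˡ-≤ (d₁ + d₁) M≤r^d)) ⟩
  r ^ suc kk₁ * (M ^ 2 * (r ^ d) ^ (d₁ + d₁))         ≤⟨ *-monoˡ-≤ _ (^-monoʳ-≤ r kk₁<2d) ⟩
  r ^ (d + d) * (M ^ 2 * (r ^ d) ^ (d₁ + d₁))         ≡⟨ swap-front (r ^ (d + d)) (M ^ 2) _ ⟩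
  M ^ 2 * (r ^ (d + d) * (r ^ d) ^ (d₁ + d₁))         ≡⟨ cong (M ^ 2 *_) r-exponents ⟩
  M ^ 2 * r ^ (d * d + d * d)                         ∎
  where
  open ≤-Reasoning
  d = suc d₁
  regroup : ∀ a b c e → 2 * a * (b * (c * e)) ≡ 2 * b * a * (c * e)
  regroup = solve-∀
  swap-front : ∀ a b c → a * (b * c) ≡ b * (a * c)
  swap-front = solve-∀
  M^2d : M ^ (d + d) ≡ M ^ 2 * M ^ (d₁ + d₁)
  M^2d = trans (cong (M ^_) (cong suc (+-suc d₁ d₁))) (^-distribˡ-+-* M 2 (d₁ + d₁))
  r-exponents : r ^ (d + d) * (r ^ d) ^ (d₁ + d₁) ≡ r ^ (d * d + d * d)
  r-exponents = begin-equality
    r ^ (d + d) * (r ^ d) ^ (d₁ + d₁)  ≡⟨ cong (r ^ (d + d) *_) (^-*-assoc r d (d₁ + d₁)) ⟩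
    r ^ (d + d) * r ^ (d * (d₁ + d₁))  ≡⟨ ^-distribˡ-+-* r (d + d) (d * (d₁ + d₁)) ⟨
    r ^ (d + d + d * (d₁ + d₁))        ≡⟨ cong (r ^_) (exponents d₁) ⟩
    r ^ (d * d + d * d)                ∎
    where
    exponents : ∀ x → suc x + suc x + suc x * (x + x) ≡ suc x * suc x + suc x * suc x
    exponents = solve-∀

edge-bound : ∀ k kk₁ d n M r e .{{_ : NonZero n}} → kk₁ ≤ k * d → n ≤ 2 * k * M → r ^ d ≤ 2 ^ d * n →
  M ^ k ≤ 2 * r ^ kk₁ * e → n ^ (k * d ∸ kk₁) ≤ ((2 * k) ^ k * 2 * 2 ^ kk₁ * e) ^ d
edge-bound k kk₁ d n M r e kk₁≤kd n≤2kM r^d≤2^dn M^k≤ = *-cancelʳ-≤ _ _ (n ^ kk₁) {{m^n≢0 n kk₁}} (begin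
  n ^ (k * d ∸ kk₁) * n ^ kk₁                ≡⟨ ^-distribˡ-+-* n (k * d ∸ kk₁) kk₁ ⟨
  n ^ (k * d ∸ kk₁ + kk₁)                    ≡⟨ cong (n ^_) (m∸n+n≡m kk₁≤kd) ⟩
  n ^ (k * d)                                ≤⟨ ^-monoˡ-≤ (k * d) n≤2kM ⟩
  (2 * k * M) ^ (k * d)                      ≡⟨ ^-*-assoc (2 * k * M) k d ⟨
  ((2 * k * M) ^ k) ^ d                      ≡⟨ cong (_^ d) (^-distribʳ-* (2 * k) M k) ⟩
  (K * M ^ k) ^ d                            ≤⟨ ^-monoˡ-≤ d (*-monoʳ-≤ K M^k≤) ⟩
  (K * (2 * r ^ kk₁ * e)) ^ d                ≡⟨ expand ⟩
  K ^ d * 2 ^ d * (r ^ d) ^ kk₁ * e ^ d      ≤⟨ *-monoˡ-≤ (e ^ d) (*-monoʳ-≤ (K ^ d * 2 ^ d) (^-monoˡ-≤ kk₁ r^d≤2^dn)) ⟩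
  K ^ d * 2 ^ d * (2 ^ d * n) ^ kk₁ * e ^ d  ≡⟨ collect ⟩
  (K * 2 * 2 ^ kk₁ * e) ^ d * n ^ kk₁        ∎)
  where
  open ≤-Reasoning
  K = (2 * k) ^ k
  expand : (K * (2 * r ^ kk₁ * e)) ^ d ≡ K ^ d * 2 ^ d * (r ^ d) ^ kk₁ * e ^ d
  expand = begin-equality
    (K * (2 * r ^ kk₁ * e)) ^ d              ≡⟨ ^-distribʳ-* K (2 * r ^ kk₁ * e) d ⟩
    K ^ d * (2 * r ^ kk₁ * e) ^ d            ≡⟨ cong (K ^ d *_) (^-distribʳ-* (2 * r ^ kk₁) e d) ⟩
    K ^ d * ((2 * r ^ kk₁) ^ d * e ^ d)      ≡⟨ cong (λ x → K ^ d * (x * e ^ d)) (^-distribʳ-* 2 (r ^ kk₁) d) ⟩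
    K ^ d * (2 ^ d * (r ^ kk₁) ^ d * e ^ d)  ≡⟨ cong (λ x → K ^ d * (2 ^ d * x * e ^ d)) (^-swap r kk₁ d) ⟩
    K ^ d * (2 ^ d * (r ^ d) ^ kk₁ * e ^ d)  ≡⟨ reassociate (K ^ d) (2 ^ d) ((r ^ d) ^ kk₁) (e ^ d) ⟩
    K ^ d * 2 ^ d * (r ^ d) ^ kk₁ * e ^ d    ∎
    where
    reassociate : ∀ a b c x → a * (b * c * x) ≡ a * b * c * x
    reassociate = solve-∀
  collect : K ^ d * 2 ^ d * (2 ^ d * n) ^ kk₁ * e ^ d ≡ (K * 2 * 2 ^ kk₁ * e) ^ d * n ^ kk₁
  collect = begin-equality
    K ^ d * 2 ^ d * (2 ^ d * n) ^ kk₁ * e ^ d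
      ≡⟨ cong (λ x → K ^ d * 2 ^ d * x * e ^ d) (^-distribʳ-* (2 ^ d) n kk₁) ⟩
    K ^ d * 2 ^ d * ((2 ^ d) ^ kk₁ * n ^ kk₁) * e ^ d
      ≡⟨ cong (λ x → K ^ d * 2 ^ d * (x * n ^ kk₁) * e ^ d) (^-swap 2 d kk₁) ⟩
    K ^ d * 2 ^ d * ((2 ^ kk₁) ^ d * n ^ kk₁) * e ^ d
      ≡⟨ move-n (K ^ d) (2 ^ d) ((2 ^ kk₁) ^ d) (n ^ kk₁) (e ^ d) ⟩
    K ^ d * 2 ^ d * (2 ^ kk₁) ^ d * e ^ d * n ^ kk₁
      ≡⟨ cong (_* n ^ kk₁) distribute ⟨
    (K * 2 * 2 ^ kk₁ * e) ^ d * n ^ kk₁ ∎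
    where
    move-n : ∀ a b c m x → a * b * (c * m) * x ≡ a * b * c * x * m
    move-n = solve-∀
    distribute : (K * 2 * 2 ^ kk₁ * e) ^ d ≡ K ^ d * 2 ^ d * (2 ^ kk₁) ^ d * e ^ d
    distribute = trans (^-distribʳ-* (K * 2 * 2 ^ kk₁) e d) (cong (_* e ^ d)
      (trans (^-distribʳ-* (K * 2) (2 ^ kk₁) d) (cong (_* (2 ^ kk₁) ^ d) (^-distribʳ-* K 2 d))))

edgeConstant : ℕ → ℕ
edgeConstant k = (2 * k) ^ k * 2 * 2 ^ (k * (k ∸ 1))

edgeConstant-positive : ∀ k₁ → 1 ≤ edgeConstant (suc k₁)
edgeConstant-positive k₁ = *-mono-≤ (*-mono-≤ (m^n>0 (2 * suc k₁) (suc k₁)) (s≤s z≤n)) (m^n>0 2 (suc k₁ * k₁))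

extremal-construction : ∀ k₂ d₁ → let k = 2 + k₂; d = suc d₁ in k * (k ∸ 1) < 2 * d →
  ∀ n → (2 * k ^ (d + d)) ^ d ≤ n →
  Σ (Hypergraph n) λ G → IsUniform k G × ¬ ContainsCopy G (hedgehog k d) ×
    n ^ (k * d ∸ k * (k ∸ 1)) ≤ (edgeConstant k * numEdges G) ^ d
extremal-construction k₂ d₁ k[k-1]<2d n N≤n = fromRoot (root-bracket d₁ R≥1 N≤n)
  where
  k₁ = suc k₂
  k = suc k₁
  d = suc d₁
  R = 2 * k ^ (d + d)
  M = n / k
  k≤R : k ≤ R
  k≤R = m≤2*m^[1+n] k (d₁ + d) (s≤s z≤n)
  R≥1 : 1 ≤ R
  R≥1 = ≤-trans (s≤s z≤n) k≤R
  k≤n : k ≤ n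
  k≤n = ≤-trans k≤R (≤-trans (m≤m^[1+n] R d₁ R≥1) N≤n)
  instance
    _ : NonZero n
    _ = >-nonZero (≤-trans (s≤s z≤n) k≤n)
  k[k-1]<d+d : suc (k * k₁) ≤ d + d
  k[k-1]<d+d = subst (suc (k * k₁) ≤_) (cong (d +_) (+-identityʳ d)) k[k-1]<2d
  kk₁≤kd : k * k₁ ≤ k * d
  kk₁≤kd = ≤-trans (<⇒≤ k[k-1]<2d) (*-monoˡ-≤ d {2} {k} (s≤s (s≤s z≤n)))
  fromRoot : (∃ λ q → R ≤ suc q × n ≤ suc q ^ d × suc q ^ d ≤ 2 ^ d * n) →
    Σ (Hypergraph n) λ G → IsUniform k G × ¬ ContainsCopy G (hedgehog k d) ×
      n ^ (k * d ∸ k * k₁) ≤ (edgeConstant k * numEdges G) ^ d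
  fromRoot (q , R≤r , n≤r^d , r^d≤2^dn) with M≥1 , kM≤n , n≤2kM ← quotient-bounds k n k≤n =
    map₂ (map₂ (map₂ (edge-bound k (k * k₁) d n M (suc q) _ kk₁≤kd n≤2kM r^d≤2^dn)))
      (RandomConstruction.dense-hedgehog-free k₁ M q d₁ kM≤n M≥1
        (sparse-condition k (k * k₁) d₁ M (suc q) R≤r (≤-trans (m/n≤m n k) n≤r^d) k[k-1]<d+d))

corollary3p5 : ∀ (k : ℕ) → 3 ≤ k →
    Σ ℕ (λ C → 1 ≤ C ×
      (∀ (d : ℕ) → k * (k ∸ 1) < 2 * d →
        Σ ℕ (λ N → ∀ (n : ℕ) → N ≤ n →
          Σ (Hypergraph n) (λ G → IsUniform k G × ¬ ContainsCopy G (hedgehog k d) ×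
            n ^ (k * d ∸ k * (k ∸ 1)) ≤ (C * numEdges G) ^ d))
        × DegeneracyIs (hedgehog k d) 1))
corollary3p5 (suc zero)       (s≤s ())
corollary3p5 (suc (suc zero)) (s≤s (s≤s ()))
corollary3p5 k@(suc (suc (suc k₃))) _ = edgeConstant k , edgeConstant-positive (suc (suc k₃)) , λ where
  zero     ()
  (suc d₁) k[k-1]<2d → (_ , extremal-construction (suc k₃) d₁ k[k-1]<2d) , Degeneracy.hedgehog-degeneracy k₃ d₁
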